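{- For $n\ge 2$, $1\le i\le n$, $1\le j\le n-1$, let $u_n(i,j)=\sum_{e\in\mathcal{U}_n(i,j)}q^{\mathrm{dist}(e)-1}$, and set $u_n(i,j)=0$ for all other $(n,i,j)$. Then for $n\ge 3$: $$u_n(i,j)=\delta_{j,n-1}q^{n-2}+u_{n-1}(j,i)+q\sum_{k=1}^{i-1}\bigl(u_{n-2}(j-1,k)+u_{n-1}(j-1,k)\bigr),\quad 1\le i<j\le n-1;$$ $$u_n(i,j)=q\sum_{\ell=1}^{i-1}u_{n-1}(\ell,j),\quad 1\le j<i\le n;$$ $$u_n(i,i)=\sum_{k=1}^{i-1}u_{n-1}(i,k)+\sum_{\ell=1}^{i}u_{n-1}(\ell,i),\quad 1\le i\le n-2;$$ moreover $u_3(2,2)=q$, $u_n(n-1,n-1)=q^{n-2}+q\sum_{i=1}^{n-2}\sum_{j=1}^{n-3}u_{n-2}(i,j)$ for $n\ge 4$, and $u_2(1,1)=1$, $u_2(2,1)=0$.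
   Context: $\mathcal{U}_n$ is the set of sequences $e=e_1\cdots e_n$ of integers with $1\le e_i\le i$ for all $i$ such that there are no indices $i<j<k$ with $e_i\ge e_j$ and $e_i>e_k$. $\mathrm{dist}(e)$ is the number of distinct values in $e$ and $\mathrm{last}(e)=e_n$. The height of $e$ is $\mathrm{hght}(e)=\max\{e_i: 1\le i\le n-1,\ e_i\ge e_{i+1}\}$ (undefined for $e=12\cdots n$). $\mathcal{U}_n(i,j)$ is the set of $e\in\mathcal{U}_n$ with $\mathrm{last}(e)=i$ and $\mathrm{hght}(e)=j$. $\delta$ is the Kronecker delta. -}

module Defs where

open import Level using (Level)
open import Data.Bool using (Bool; true; false; _∧_; _∨_; not; if_then_else_)
open import Data.Nat using (ℕ; zero; suc; _∸_; _≤ᵇ_; _<ᵇ_; _≡ᵇ_; _⊔_)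
open import Data.Nat.Properties using (_≟_)
open import Data.List using (List; []; _∷_; _++_; [_]; map; concatMap; applyUpTo; foldr; length; filter; deduplicate; last)
open import Data.Bool.ListAction using (any)
open import Data.Maybe using (Maybe; just; nothing)
open import Relation.Nullary.Decidable using (⌊_⌋)
open import Algebra.Bundles using (CommutativeSemiring)

invSeqs : ℕ → List (List ℕ)
invSeqs zero    = [] ∷ []
invSeqs (suc n) = concatMap (λ e → map (λ v → e ++ [ v ]) (applyUpTo suc (suc n))) (invSeqs n)

_≥ᵇ_ : ℕ → ℕ → Bool
x ≥ᵇ y = y ≤ᵇ x

badFrom : ℕ → List ℕ → Bool
badFrom x []       = false
badFrom x (y ∷ ys) = (x ≥ᵇ y ∧ any (λ z → z <ᵇ x) ys) ∨ badFrom x ys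

-- no indices i<j<k with eᵢ ≥ eⱼ and eᵢ > eₖ
avoids : List ℕ → Bool
avoids []       = true
avoids (x ∷ xs) = not (badFrom x xs) ∧ avoids xs

𝒰 : ℕ → List (List ℕ)
𝒰 n = filter (λ e → avoids e Data.Bool.≟ true) (invSeqs n)

dist : List ℕ → ℕ
dist e = length (deduplicate _≟_ e)

descTops : List ℕ → List ℕ
descTops []           = []
descTops (x ∷ [])     = []
descTops (x ∷ y ∷ ys) = if x ≥ᵇ y then x ∷ descTops (y ∷ ys) else descTops (y ∷ ys)

hght : List ℕ → Maybe ℕ
hght e with descTops e
... | []     = nothing
... | x ∷ xs = just (foldr _⊔_ x xs)

lastE : List ℕ → Maybe ℕ
lastE = last

_=ᴹ_ : Maybe ℕ → ℕ → Bool
just x  =ᴹ y = x ≡ᵇ y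
nothing =ᴹ y = false

𝒰ij : ℕ → ℕ → ℕ → List (List ℕ)
𝒰ij n i j = filter (λ e → ((lastE e =ᴹ i) ∧ (hght e =ᴹ j)) Data.Bool.≟ true) (𝒰 n)

-- Values in an arbitrary commutative semiring R, with q ∈ R.
-- (A polynomial identity in q is an identity in every commutative semiring.)

module Poly {c ℓ : Level} (R : CommutativeSemiring c ℓ) (q : CommutativeSemiring.Carrier R) where
  open CommutativeSemiring R

  pow : Carrier → ℕ → Carrier
  pow x zero    = 1#
  pow x (suc n) = x * pow x n

  Σ[1‥_] : ℕ → (ℕ → Carrier) → Carrier
  Σ[1‥ m ] f = foldr (λ k acc → f k + acc) 0# (applyUpTo suc m)

  δ : ℕ → ℕ → Carrier
  δ a b = if a ≡ᵇ b then 1# else 0#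

  -- uₙ(i,j) = Σ_{e ∈ 𝒰ₙ(i,j)} q^{dist(e)-1}
  -- (0 automatically outside n ≥ 2, 1 ≤ i ≤ n, 1 ≤ j ≤ n-1)
  u : ℕ → ℕ → ℕ → Carrier
  u n i j = foldr (λ e acc → pow q (dist e ∸ 1) + acc) 0# (𝒰ij n i j)

{-# OPTIONS --safe #-}
module Submission where

-- Every sequence of length n + 1 is e ++ [ v ] with e of length n, and the three
-- statistics change locally: e ++ [ v ] still avoids the pattern iff v is not below
-- hght e (a larger earlier descent top would complete it); the height becomes
-- hght e ⊔ last e when v ≤ last e and stays hght e otherwise; dist grows iff v ∉ e.
-- In addition, a value of e above last e is at most hght e. So uₙ(i,j) is a sum over
-- 𝒰ₙ₋₁ of local contributions, and the cases of the theorem are the case analyses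
-- of last e and hght e against i and j. The one subtle case is i < j with
-- hght e = k < i, where the weight depends on whether i occurs in e: the sequences
-- of 𝒰ₚ(l,k) containing i and those avoiding i satisfy the same recursion in p,
-- which gives Σ_{l' < l} (those containing i) = (those avoiding i, ending at l).

open import Defs
open import Level using (Level)
open import Data.Nat using (ℕ; zero; suc; _∸_; _≤_; _<_; _≤ᵇ_; _<ᵇ_; _≡ᵇ_; _⊔_; z≤n; s≤s)
  renaming (_+_ to _+ℕ_)
open import Data.Nat.Properties
  using ( _≟_; _<?_; <-cmp; ≡ᵇ⇒≡; ≤ᵇ⇒≤; ≤⇒≤ᵇ; <ᵇ⇒<; <⇒<ᵇ; ≰⇒>; ≮⇒≥; <⇒≱; <⇒≢; <⇒≤; ≤∧≢⇒<
        ; ≤-refl; ≤-trans; ≤-antisym; ≤-pred; <-trans; <-≤-trans; <-irrefl; n<1+n; n≤1+n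
        ; m≤n⇒m≤1+n; m<n⇒m<1+n; m∸n≤m; ⊔-comm; ⊔-assoc; ⊔-idem; ⊔-sel; ⊔-lub; m≤m⊔n; m≤n⊔m
        ; m≤n⇒m⊔n≡n; <⇒≤pred)
import Data.Nat.Properties as ℕₚ
open import Data.Bool using (Bool; true; false; _∧_; _∨_; not; if_then_else_; T)
open import Data.Bool.Properties using (T-≡; ∨-identityʳ; ∨-zeroʳ; ∧-zeroʳ; ∧-identityʳ; ∨-assoc)
open import Data.Bool.Solver using (module ∨-∧-Solver)
open import Data.Bool.ListAction using (any)
open import Data.List using (List; []; _∷_; _++_; [_]; map; concatMap; applyUpTo; foldr; length; filter; deduplicate; last)
open import Data.List.Properties using (filter-++; length-++; applyUpTo-∷ʳ; ++-identityʳ)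
open import Data.List.Relation.Unary.All as All using (All; []; _∷_)
open import Data.List.Relation.Unary.All.Properties using (concat⁺; map⁺; applyUpTo⁺₁)
open import Data.Maybe using (Maybe; just; nothing; is-nothing)
open import Data.Maybe.Properties using (just-injective)
open import Data.Product using (Σ; _×_; _,_; proj₁; proj₂)
open import Data.Sum using (inj₁; inj₂)
open import Data.Empty using (⊥-elim)
open import Function.Bundles using (Equivalence)
open import Relation.Nullary using (¬?; Dec; yes; no)
open import Relation.Nullary.Decidable using (does)
open import Relation.Binary using (tri<; tri≈; tri>)
open import Relation.Binary.PropositionalEquality
  using (_≡_; _≢_; refl; sym; trans; cong; cong₂; subst)
open import Relation.Unary using (Decidable)
open import Algebra.Bundles using (CommutativeSemiring)

≡ᵇ-refl : ∀ n → (n ≡ᵇ n) ≡ true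
≡ᵇ-refl zero    = refl
≡ᵇ-refl (suc n) = ≡ᵇ-refl n

≡ᵇ-sym : ∀ m n → (m ≡ᵇ n) ≡ (n ≡ᵇ m)
≡ᵇ-sym zero    zero    = refl
≡ᵇ-sym zero    (suc n) = refl
≡ᵇ-sym (suc m) zero    = refl
≡ᵇ-sym (suc m) (suc n) = ≡ᵇ-sym m n

≡ᵇ-true⇒≡ : ∀ {m n} → (m ≡ᵇ n) ≡ true → m ≡ n
≡ᵇ-true⇒≡ {m} {n} e = ≡ᵇ⇒≡ m n (Equivalence.from T-≡ e)

≢⇒≡ᵇ-false : ∀ {m n} → m ≢ n → (m ≡ᵇ n) ≡ false
≢⇒≡ᵇ-false {m} {n} m≢n with m ≡ᵇ n in eq
... | false = refl
... | true  = ⊥-elim (m≢n (≡ᵇ-true⇒≡ eq))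

≤ᵇ-true⇒≤ : ∀ {m n} → (m ≤ᵇ n) ≡ true → m ≤ n
≤ᵇ-true⇒≤ {m} {n} e = ≤ᵇ⇒≤ m n (Equivalence.from T-≡ e)

≤ᵇ-false⇒> : ∀ {m n} → (m ≤ᵇ n) ≡ false → n < m
≤ᵇ-false⇒> e = ≰⇒> (λ m≤n → subst T e (≤⇒≤ᵇ m≤n))

≤⇒≤ᵇ-true : ∀ {m n} → m ≤ n → (m ≤ᵇ n) ≡ true
≤⇒≤ᵇ-true m≤n = Equivalence.to T-≡ (≤⇒≤ᵇ m≤n)

>⇒≤ᵇ-false : ∀ {m n} → n < m → (m ≤ᵇ n) ≡ false
>⇒≤ᵇ-false {m} {n} n<m with m ≤ᵇ n in eq
... | false = refl
... | true  = ⊥-elim (<⇒≱ n<m (≤ᵇ-true⇒≤ eq))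

<ᵇ-true⇒< : ∀ {m n} → (m <ᵇ n) ≡ true → m < n
<ᵇ-true⇒< {m} {n} e = <ᵇ⇒< m n (Equivalence.from T-≡ e)

<⇒<ᵇ-true : ∀ {m n} → m < n → (m <ᵇ n) ≡ true
<⇒<ᵇ-true m<n = Equivalence.to T-≡ (<⇒<ᵇ m<n)

≥⇒<ᵇ-false : ∀ {m n} → n ≤ m → (m <ᵇ n) ≡ false
≥⇒<ᵇ-false {m} {n} n≤m with m <ᵇ n in eq
... | false = refl
... | true  = ⊥-elim (<⇒≱ (<ᵇ-true⇒< eq) n≤m)

<ᵇ-false⇒≥ : ∀ {m n} → (m <ᵇ n) ≡ false → n ≤ m
<ᵇ-false⇒≥ e = ≮⇒≥ (λ m<n → subst T e (<⇒<ᵇ m<n))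

<ᵇ-irrefl : ∀ n → (n <ᵇ n) ≡ false
<ᵇ-irrefl n = ≥⇒<ᵇ-false {n} ≤-refl

<ᵇ-⊔ : ∀ v a b → (v <ᵇ (a ⊔ b)) ≡ ((v <ᵇ a) ∨ (v <ᵇ b))
<ᵇ-⊔ v       zero    b       = refl
<ᵇ-⊔ v       (suc a) zero    = sym (∨-identityʳ _)
<ᵇ-⊔ zero    (suc a) (suc b) = refl
<ᵇ-⊔ (suc v) (suc a) (suc b) = <ᵇ-⊔ v a b

pred-< : ∀ {x l} → 1 ≤ x → l ≤ x → l ∸ 1 < x
pred-< {l = zero}  1≤x _   = 1≤x
pred-< {l = suc l} _   l≤x = l≤x

≤pred⇒< : ∀ {l' l} → 1 ≤ l → l' ≤ l ∸ 1 → l' < l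
≤pred⇒< {l = suc l} _ l'≤l = s≤s l'≤l

_∈ᵇ_ : ℕ → List ℕ → Bool
x ∈ᵇ []       = false
x ∈ᵇ (y ∷ ys) = (y ≡ᵇ x) ∨ (x ∈ᵇ ys)

∈ᵇ-snoc : ∀ x xs v → x ∈ᵇ (xs ++ [ v ]) ≡ (x ∈ᵇ xs) ∨ (v ≡ᵇ x)
∈ᵇ-snoc x []       v = ∨-identityʳ _
∈ᵇ-snoc x (y ∷ ys) v rewrite ∈ᵇ-snoc x ys v = sym (∨-assoc (y ≡ᵇ x) (x ∈ᵇ ys) (v ≡ᵇ x))

∈ᵇ-snoc-≢ : ∀ x xs {v} → v ≢ x → x ∈ᵇ (xs ++ [ v ]) ≡ x ∈ᵇ xs
∈ᵇ-snoc-≢ x xs {v} v≢x rewrite ∈ᵇ-snoc x xs v | ≢⇒≡ᵇ-false v≢x = ∨-identityʳ _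

∈ᵇ-snoc-≡ : ∀ x xs → x ∈ᵇ (xs ++ [ x ]) ≡ true
∈ᵇ-snoc-≡ x xs rewrite ∈ᵇ-snoc x xs x | ≡ᵇ-refl x = ∨-zeroʳ _

last-snoc : ∀ (xs : List ℕ) v → last (xs ++ [ v ]) ≡ just v
last-snoc []           v = refl
last-snoc (x ∷ [])     v = refl
last-snoc (x ∷ y ∷ ys) v = last-snoc (y ∷ ys) v

last⇒∈ᵇ : ∀ xs {x} → last xs ≡ just x → x ∈ᵇ xs ≡ true
last⇒∈ᵇ []           ()
last⇒∈ᵇ (y ∷ [])     refl rewrite ≡ᵇ-refl y = refl
last⇒∈ᵇ (y ∷ z ∷ zs) e    rewrite last⇒∈ᵇ (z ∷ zs) e = ∨-zeroʳ _

deduplicate-snoc : ∀ xs v → deduplicate _≟_ (xs ++ [ v ]) ≡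
                   deduplicate _≟_ xs ++ (if v ∈ᵇ xs then [] else [ v ])
deduplicate-snoc []       v = refl
deduplicate-snoc (x ∷ xs) v
  rewrite deduplicate-snoc xs v
        | filter-++ (λ y → ¬? (x ≟ y)) (deduplicate _≟_ xs) (if v ∈ᵇ xs then [] else [ v ])
        = cong (λ t → x ∷ (filter (λ y → ¬? (x ≟ y)) (deduplicate _≟_ xs) ++ t)) (filter-new (v ∈ᵇ xs))
  where
  filter-new : ∀ b → filter (λ y → ¬? (x ≟ y)) (if b then [] else [ v ]) ≡
                     (if (x ≡ᵇ v) ∨ b then [] else [ v ])
  filter-new true  rewrite ∨-zeroʳ (x ≡ᵇ v) = refl
  filter-new false rewrite ∨-identityʳ (x ≡ᵇ v) with x ≡ᵇ v
  ... | true  = refl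
  ... | false = refl

dist-snoc : ∀ xs v → dist (xs ++ [ v ]) ≡ dist xs +ℕ (if v ∈ᵇ xs then 0 else 1)
dist-snoc xs v
  rewrite deduplicate-snoc xs v
        | length-++ (deduplicate _≟_ xs) {if v ∈ᵇ xs then [] else [ v ]}
  with v ∈ᵇ xs
... | true  = refl
... | false = refl

-- Height and pattern avoidance under appending

_⊔ᴹ_ : Maybe ℕ → Maybe ℕ → Maybe ℕ
nothing ⊔ᴹ m       = m
just a  ⊔ᴹ nothing = just a
just a  ⊔ᴹ just b  = just (a ⊔ b)

⊔ᴹ-identityʳ : ∀ h → h ⊔ᴹ nothing ≡ h
⊔ᴹ-identityʳ nothing  = refl
⊔ᴹ-identityʳ (just x) = refl

⊔ᴹ-just-≥ʳ : ∀ h x → Σ ℕ λ r → h ⊔ᴹ just x ≡ just r × x ≤ r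
⊔ᴹ-just-≥ʳ nothing  x = x , refl , ≤-refl
⊔ᴹ-just-≥ʳ (just a) x = a ⊔ x , refl , m≤n⊔m a x

⊔ᴹ-just-≥ˡ : ∀ a m → Σ ℕ λ r → just a ⊔ᴹ m ≡ just r × a ≤ r
⊔ᴹ-just-≥ˡ a nothing  = a , refl , ≤-refl
⊔ᴹ-just-≥ˡ a (just x) = a ⊔ x , refl , m≤m⊔n a x

maxᴹ : List ℕ → Maybe ℕ
maxᴹ []       = nothing
maxᴹ (x ∷ xs) = just (foldr _⊔_ x xs)

hght≡maxᴹ-descTops : ∀ e → hght e ≡ maxᴹ (descTops e)
hght≡maxᴹ-descTops e with descTops e
... | []     = refl
... | x ∷ xs = refl

maxᴹ-snoc : ∀ ts x → maxᴹ (ts ++ [ x ]) ≡ maxᴹ ts ⊔ᴹ just x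
maxᴹ-snoc []       x = refl
maxᴹ-snoc (t ∷ ts) x = cong just (foldr-⊔-snoc t ts)
  where
  foldr-⊔-snoc : ∀ a ts → foldr _⊔_ a (ts ++ [ x ]) ≡ foldr _⊔_ a ts ⊔ x
  foldr-⊔-snoc a []       = ⊔-comm x a
  foldr-⊔-snoc a (t ∷ ts) rewrite foldr-⊔-snoc a ts = sym (⊔-assoc t (foldr _⊔_ a ts) x)

descTops-snoc : ∀ e {x} v → last e ≡ just x →
                descTops (e ++ [ v ]) ≡ descTops e ++ (if v ≤ᵇ x then [ x ] else [])
descTops-snoc []           v ()
descTops-snoc (a ∷ [])     v refl with v ≤ᵇ a
... | true  = refl
... | false = refl
descTops-snoc (a ∷ b ∷ ys) v e = cons-if (b ≤ᵇ a) (descTops-snoc (b ∷ ys) v e)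
  where
  cons-if : ∀ c {L R T} → L ≡ R ++ T → (if c then a ∷ L else L) ≡ (if c then a ∷ R else R) ++ T
  cons-if true  refl = refl
  cons-if false refl = refl

hghtAfter : Maybe ℕ → ℕ → ℕ → Maybe ℕ
hghtAfter h x v = h ⊔ᴹ (if v ≤ᵇ x then just x else nothing)

hght-snoc : ∀ e {x} v → last e ≡ just x → hght (e ++ [ v ]) ≡ hghtAfter (hght e) x v
hght-snoc e {x} v lx
  rewrite hght≡maxᴹ-descTops (e ++ [ v ]) | hght≡maxᴹ-descTops e | descTops-snoc e v lx
  with v ≤ᵇ x
... | true  = maxᴹ-snoc (descTops e) x
... | false rewrite ++-identityʳ (descTops e) = sym (⊔ᴹ-identityʳ _)

hghtAfter≡nothing : ∀ h x v → hghtAfter h x v ≡ nothing → h ≡ nothing × (v ≤ᵇ x) ≡ false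
hghtAfter≡nothing h x v e with h | v ≤ᵇ x
... | nothing | false = refl , refl
... | nothing | true  with () ← e
... | just _  | true  with () ← e
... | just _  | false with () ← e

_<ᴹ_ : ℕ → Maybe ℕ → Bool
v <ᴹ nothing = false
v <ᴹ just h  = v <ᵇ h

<ᴹ-maxᴹ : ∀ ts v → any (v <ᵇ_) ts ≡ v <ᴹ maxᴹ ts
<ᴹ-maxᴹ []       v = refl
<ᴹ-maxᴹ (t ∷ ts) v = sym (<ᵇ-foldr t ts)
  where
  open ∨-∧-Solver using (solve; _:+_; _:=_)
  <ᵇ-foldr : ∀ a ts → (v <ᵇ foldr _⊔_ a ts) ≡ ((v <ᵇ a) ∨ any (v <ᵇ_) ts)
  <ᵇ-foldr a []       = sym (∨-identityʳ _)
  <ᵇ-foldr a (t ∷ ts) rewrite <ᵇ-⊔ v t (foldr _⊔_ a ts) | <ᵇ-foldr a ts =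
    solve 3 (λ a t r → t :+ (a :+ r) := a :+ (t :+ r)) refl (v <ᵇ a) (v <ᵇ t) (any (v <ᵇ_) ts)

-- Whether e has j < k with e_j ≥ e_k and e_j > v, i.e. whether appending v creates the pattern.
completesPattern : List ℕ → ℕ → Bool
completesPattern []       v = false
completesPattern (x ∷ xs) v = ((v <ᵇ x) ∧ any (_≤ᵇ x) xs) ∨ completesPattern xs v

any-snoc : ∀ (p : ℕ → Bool) xs v → any p (xs ++ [ v ]) ≡ any p xs ∨ p v
any-snoc p []       v = ∨-identityʳ _
any-snoc p (y ∷ ys) v rewrite any-snoc p ys v = sym (∨-assoc (p y) (any p ys) (p v))

badFrom-snoc : ∀ x ys v → badFrom x (ys ++ [ v ]) ≡ badFrom x ys ∨ ((v <ᵇ x) ∧ any (_≤ᵇ x) ys)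
badFrom-snoc x []       v rewrite ∧-zeroʳ (v ≤ᵇ x) | ∧-zeroʳ (v <ᵇ x) = refl
badFrom-snoc x (y ∷ ys) v rewrite any-snoc (_<ᵇ x) ys v | badFrom-snoc x ys v =
  solve 5 (λ a b c d e → (a :* (b :+ c)) :+ (d :+ (c :* e)) := ((a :* b) :+ d) :+ (c :* (a :+ e))) refl
    (y ≤ᵇ x) (any (_<ᵇ x) ys) (v <ᵇ x) (badFrom x ys) (any (_≤ᵇ x) ys)
  where
  open ∨-∧-Solver using (solve; _:+_; _:*_; _:=_)

avoids-snoc′ : ∀ e v → avoids (e ++ [ v ]) ≡ avoids e ∧ not (completesPattern e v)
avoids-snoc′ []       v = refl
avoids-snoc′ (x ∷ xs) v rewrite badFrom-snoc x xs v | avoids-snoc′ xs v =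
  not-∨-∧ (badFrom x xs) ((v <ᵇ x) ∧ any (_≤ᵇ x) xs) (avoids xs) (completesPattern xs v)
  where
  not-∨-∧ : ∀ a b c d → (not (a ∨ b) ∧ (c ∧ not d)) ≡ ((not a ∧ c) ∧ not (b ∨ d))
  not-∨-∧ true  b     c d = refl
  not-∨-∧ false true  c d rewrite ∧-zeroʳ c = refl
  not-∨-∧ false false c d = refl

descTop-above : ∀ {v x} y ys → (v <ᵇ x) ≡ true → (y ≤ᵇ x) ≡ false → any (_≤ᵇ x) ys ≡ true →
                any (v <ᵇ_) (descTops (y ∷ ys)) ≡ true
descTop-above y [] _ _ ()
descTop-above {v} {x} y (z ∷ zs) v<x x<y z≤x-somewhere with z ≤ᵇ x in z≤x
... | true rewrite ≤⇒≤ᵇ-true {z} {y} (≤-trans (≤ᵇ-true⇒≤ z≤x) (<⇒≤ (≤ᵇ-false⇒> x<y)))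
                 | <⇒<ᵇ-true {v} {y} (<-trans (<ᵇ-true⇒< v<x) (≤ᵇ-false⇒> x<y)) = refl
... | false with z ≤ᵇ y
...   | true rewrite descTop-above z zs v<x z≤x z≤x-somewhere = ∨-zeroʳ _
...   | false = descTop-above z zs v<x z≤x z≤x-somewhere

completesPattern≡any-descTops : ∀ e v → completesPattern e v ≡ any (v <ᵇ_) (descTops e)
completesPattern≡any-descTops []           v = refl
completesPattern≡any-descTops (x ∷ [])     v rewrite ∧-zeroʳ (v <ᵇ x) = refl
completesPattern≡any-descTops (x ∷ y ∷ ys) v
  rewrite completesPattern≡any-descTops (y ∷ ys) v with y ≤ᵇ x in y≤x
... | true rewrite ∧-identityʳ (v <ᵇ x) = refl
... | false with v <ᵇ x in v<x | any (_≤ᵇ x) ys in later≤x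
...   | true  | true  rewrite descTop-above y ys v<x y≤x later≤x = refl
...   | true  | false = refl
...   | false | _     = refl

avoids-snoc : ∀ e v → avoids (e ++ [ v ]) ≡ avoids e ∧ not (v <ᴹ hght e)
avoids-snoc e v rewrite avoids-snoc′ e v | completesPattern≡any-descTops e v
                      | hght≡maxᴹ-descTops e | <ᴹ-maxᴹ (descTops e) v = refl

data IsInvSeq : ℕ → List ℕ → Set where
  []   : IsInvSeq 0 []
  snoc : ∀ {n e v} → IsInvSeq n e → 1 ≤ v → v ≤ suc n → IsInvSeq (suc n) (e ++ [ v ])

invSeqs-IsInvSeq : ∀ n → All (IsInvSeq n) (invSeqs n)
invSeqs-IsInvSeq zero    = [] ∷ []
invSeqs-IsInvSeq (suc n) = concat⁺ (map⁺ (All.map extensions (invSeqs-IsInvSeq n)))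
  where
  extensions : ∀ {e} → IsInvSeq n e → All (IsInvSeq (suc n)) (map (λ v → e ++ [ v ]) (applyUpTo suc (suc n)))
  extensions e-inv = map⁺ (applyUpTo⁺₁ suc (suc n) (snoc e-inv (s≤s z≤n)))

IsInvSeq-0 : ∀ {e} → IsInvSeq 0 e → e ≡ []
IsInvSeq-0 [] = refl

IsInvSeq-last : ∀ {n e} → IsInvSeq (suc n) e → Σ ℕ λ x → last e ≡ just x × 1 ≤ x × x ≤ suc n
IsInvSeq-last (snoc {e = e} {v} _ 1≤v v≤n) = v , last-snoc e v , 1≤v , v≤n

IsInvSeq-∈ᵇ : ∀ {n e x} → IsInvSeq n e → x ∈ᵇ e ≡ true → 1 ≤ x × x ≤ n
IsInvSeq-∈ᵇ [] ()
IsInvSeq-∈ᵇ {x = x} (snoc {e = e} {v} e-inv 1≤v v≤n) x∈ with x ∈ᵇ e in x∈e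
... | true  = proj₁ (IsInvSeq-∈ᵇ e-inv x∈e) , m≤n⇒m≤1+n (proj₂ (IsInvSeq-∈ᵇ e-inv x∈e))
... | false rewrite ∈ᵇ-snoc x e v | x∈e | ≡ᵇ-true⇒≡ {v} {x} x∈ = 1≤v , v≤n

>length⇒∉ᵇ : ∀ {n e x} → IsInvSeq n e → n < x → x ∈ᵇ e ≡ false
>length⇒∉ᵇ {e = e} {x} e-inv n<x with x ∈ᵇ e in x∈e
... | false = refl
... | true  = ⊥-elim (<⇒≱ n<x (proj₂ (IsInvSeq-∈ᵇ e-inv x∈e)))

hght-range : ∀ {n e h} → IsInvSeq n e → hght e ≡ just h → 1 ≤ h × h < n
hght-range [] ()
hght-range (snoc {zero} e-inv _ _) eh rewrite IsInvSeq-0 e-inv with () ← eh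
hght-range (snoc {suc n} {e} {v} e-inv _ _) eh with IsInvSeq-last e-inv
... | x , lx , 1≤x , x≤n rewrite hght-snoc e v lx with hght e in he | v ≤ᵇ x
...   | nothing | true  rewrite just-injective (sym eh) = 1≤x , s≤s x≤n
...   | nothing | false with () ← eh
...   | just h₀ | true  rewrite just-injective (sym eh) =
  ≤-trans (proj₁ (hght-range e-inv he)) (m≤m⊔n h₀ x) , ⊔-lub (m<n⇒m<1+n (proj₂ (hght-range e-inv he))) (s≤s x≤n)
...   | just h₀ | false rewrite just-injective (sym eh) =
  proj₁ (hght-range e-inv he) , m<n⇒m<1+n (proj₂ (hght-range e-inv he))

hght-∈ᵇ : ∀ {n e h} → IsInvSeq n e → hght e ≡ just h → h ∈ᵇ e ≡ true
hght-∈ᵇ [] ()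
hght-∈ᵇ (snoc {zero} e-inv _ _) eh rewrite IsInvSeq-0 e-inv with () ← eh
hght-∈ᵇ {h = h} (snoc {suc n} {e} {v} e-inv _ _) eh with IsInvSeq-last e-inv
... | x , lx , _ rewrite hght-snoc e v lx | ∈ᵇ-snoc h e v with hght e in he | v ≤ᵇ x
...   | nothing | true  rewrite just-injective (sym eh) | last⇒∈ᵇ e lx = refl
...   | nothing | false with () ← eh
...   | just h₀ | false rewrite just-injective (sym eh) | hght-∈ᵇ e-inv he = refl
...   | just h₀ | true  rewrite just-injective (sym eh) with ⊔-sel h₀ x
...     | inj₁ h₀⊔x≡h₀ rewrite h₀⊔x≡h₀ | hght-∈ᵇ e-inv he = refl
...     | inj₂ h₀⊔x≡x  rewrite h₀⊔x≡x  | last⇒∈ᵇ e lx = refl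

-- The sequence must descend somewhere after an occurrence of y, since it ends below y;
-- the first such descent has top ≥ y.
above-last⇒≤hght : ∀ {n e x y} → IsInvSeq n e → last e ≡ just x → y ∈ᵇ e ≡ true → x < y →
                   Σ ℕ λ h → hght e ≡ just h × y ≤ h
above-last⇒≤hght [] () _ _
above-last⇒≤hght {y = y} (snoc {zero} {e} {v} e-inv _ _) lx y∈ x<y
  rewrite IsInvSeq-0 e-inv | just-injective (sym lx) | ∨-identityʳ (v ≡ᵇ y) | ≡ᵇ-true⇒≡ {v} {y} y∈ =
  ⊥-elim (<-irrefl refl x<y)
above-last⇒≤hght {y = y} (snoc {suc n} {e} {v} e-inv _ _) lx y∈ x<y
  rewrite last-snoc e v | just-injective (sym lx) | ∈ᵇ-snoc y e v with IsInvSeq-last e-inv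
... | x₀ , lx₀ , _ rewrite hght-snoc e v lx₀ with y ∈ᵇ e in y∈e | v ≡ᵇ y in v≡y
...   | false | false with () ← y∈
...   | false | true rewrite ≡ᵇ-true⇒≡ {v} {y} v≡y = ⊥-elim (<-irrefl refl x<y)
...   | true  | _ with x₀ <? y
...     | yes x₀<y with above-last⇒≤hght e-inv lx₀ y∈e x₀<y
...       | h₀ , he , y≤h₀ rewrite he with ⊔ᴹ-just-≥ˡ h₀ (if v ≤ᵇ x₀ then just x₀ else nothing)
...         | r , er , h₀≤r = r , er , ≤-trans y≤h₀ h₀≤r
above-last⇒≤hght {y = y} (snoc {suc n} {e} {v} e-inv _ _) lx y∈ x<y
  | x₀ , lx₀ , _ | true | _ | no x₀≮y
  rewrite ≤⇒≤ᵇ-true {v} {x₀} (≤-trans (<⇒≤ x<y) (≮⇒≥ x₀≮y)) with ⊔ᴹ-just-≥ʳ (hght e) x₀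
... | r , er , x₀≤r = r , er , ≤-trans (≮⇒≥ x₀≮y) x₀≤r

∉ᵇ-above-last-and-hght : ∀ {n e l k i} → IsInvSeq n e → last e ≡ just l → hght e ≡ just k →
                          l < i → k < i → i ∈ᵇ e ≡ false
∉ᵇ-above-last-and-hght {e = e} {i = i} e-inv lx he l<i k<i with i ∈ᵇ e in i∈e
... | false = refl
... | true with above-last⇒≤hght e-inv lx i∈e l<i
...   | h , he′ , i≤h rewrite he with just-injective he′
...     | refl = ⊥-elim (<⇒≱ k<i i≤h)

ascending : ℕ → List ℕ
ascending zero    = []
ascending (suc n) = ascending n ++ [ suc n ]

IsInvSeq-ascending : ∀ n → IsInvSeq n (ascending n)
IsInvSeq-ascending zero    = []
IsInvSeq-ascending (suc n) = snoc (IsInvSeq-ascending n) (s≤s z≤n) ≤-refl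

last-ascending : ∀ n → 1 ≤ n → last (ascending n) ≡ just n
last-ascending (suc n) _ = last-snoc (ascending n) (suc n)

hght-ascending : ∀ n → hght (ascending n) ≡ nothing
hght-ascending zero          = refl
hght-ascending (suc zero)    = refl
hght-ascending (suc (suc n)) =
  trans (hght-snoc (ascending (suc n)) (suc (suc n)) (last-snoc (ascending n) (suc n)))
        (cong₂ (λ h b → h ⊔ᴹ (if b then just (suc n) else nothing)) (hght-ascending (suc n)) (<ᵇ-irrefl n))

hght-ascending-snoc : ∀ m v → 1 ≤ m → hght (ascending m ++ [ v ]) ≡ (if v ≤ᵇ m then just m else nothing)
hght-ascending-snoc m v 1≤m rewrite hght-snoc (ascending m) v (last-ascending m 1≤m) | hght-ascending m = refl

dist-ascending : ∀ n → dist (ascending n) ≡ n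
dist-ascending zero    = refl
dist-ascending (suc n)
  rewrite dist-snoc (ascending n) (suc n) | >length⇒∉ᵇ (IsInvSeq-ascending n) (n<1+n n) | dist-ascending n =
  ℕₚ.+-comm n 1

∈ᵇ-ascending : ∀ n i → 1 ≤ i → i ≤ n → i ∈ᵇ ascending n ≡ true
∈ᵇ-ascending zero    i 1≤i i≤0 with () ← ≤-trans 1≤i i≤0
∈ᵇ-ascending (suc n) i 1≤i i≤n with i ≟ suc n
... | yes refl = ∈ᵇ-snoc-≡ (suc n) (ascending n)
... | no  i≢n  rewrite ∈ᵇ-snoc-≢ i (ascending n) (λ e → i≢n (sym e)) =
  ∈ᵇ-ascending n i 1≤i (≤-pred (≤∧≢⇒< i≤n i≢n))

hght≡nothing⇒ascending : ∀ {n e} → IsInvSeq n e → hght e ≡ nothing → e ≡ ascending n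
hght≡nothing⇒ascending [] _ = refl
hght≡nothing⇒ascending (snoc {zero} e-inv 1≤v v≤1) _ rewrite IsInvSeq-0 e-inv | ≤-antisym v≤1 1≤v = refl
hght≡nothing⇒ascending (snoc {suc n} {e} {v} e-inv _ v≤n) eh with IsInvSeq-last e-inv
... | x , lx , _ with hghtAfter≡nothing (hght e) x v (trans (sym (hght-snoc e v lx)) eh)
...   | he , x<v rewrite hght≡nothing⇒ascending e-inv he
  with just-injective (trans (sym (last-snoc (ascending n) (suc n))) lx)
...     | refl rewrite ≤-antisym v≤n (≤ᵇ-false⇒> x<v) = refl

-- Weighted sums in a commutative semiring

module Recurrences {c ℓ : Level} (R : CommutativeSemiring c ℓ) (q : CommutativeSemiring.Carrier R) where
  open CommutativeSemiring R renaming (refl to ≈-refl; sym to ≈-sym; trans to ≈-trans)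
  open Poly R q
  open import Relation.Binary.Reasoning.Setoid setoid
  open import Algebra.Solver.Ring.NaturalCoefficients R (λ _ _ → nothing) using (solve; _:+_; _:*_; _:=_)

  ≡⇒≈ : ∀ {a b} → a ≡ b → a ≈ b
  ≡⇒≈ refl = ≈-refl

  ind : Bool → Carrier → Carrier
  ind b x = if b then x else 0#

  sumOver : {A : Set} → List A → (A → Carrier) → Carrier
  sumOver xs f = foldr (λ x acc → f x + acc) 0# xs

  sumOver-cong : {A : Set} (xs : List A) {f g : A → Carrier} → (∀ x → f x ≈ g x) →
                 sumOver xs f ≈ sumOver xs g
  sumOver-cong []       f≈g = ≈-refl
  sumOver-cong (x ∷ xs) f≈g = +-cong (f≈g x) (sumOver-cong xs f≈g)

  sumOver-congᴬ : {A : Set} {P : A → Set} (xs : List A) {f g : A → Carrier} → All P xs →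
                  (∀ x → P x → f x ≈ g x) → sumOver xs f ≈ sumOver xs g
  sumOver-congᴬ []       []         f≈g = ≈-refl
  sumOver-congᴬ (x ∷ xs) (px ∷ pxs) f≈g = +-cong (f≈g x px) (sumOver-congᴬ xs pxs f≈g)

  sumOver-++ : {A : Set} (xs ys : List A) (f : A → Carrier) →
               sumOver (xs ++ ys) f ≈ sumOver xs f + sumOver ys f
  sumOver-++ []       ys f = ≈-sym (+-identityˡ _)
  sumOver-++ (x ∷ xs) ys f = ≈-trans (+-congˡ (sumOver-++ xs ys f)) (≈-sym (+-assoc _ _ _))

  sumOver-concatMap : {A B : Set} (g : A → List B) (xs : List A) (f : B → Carrier) →
                      sumOver (concatMap g xs) f ≈ sumOver xs (λ x → sumOver (g x) f)
  sumOver-concatMap g []       f = ≈-refl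
  sumOver-concatMap g (x ∷ xs) f = ≈-trans (sumOver-++ (g x) (concatMap g xs) f) (+-congˡ (sumOver-concatMap g xs f))

  sumOver-map : {A B : Set} (g : A → B) (xs : List A) (f : B → Carrier) →
                sumOver (map g xs) f ≡ sumOver xs (λ x → f (g x))
  sumOver-map g []       f = refl
  sumOver-map g (x ∷ xs) f = cong (f (g x) +_) (sumOver-map g xs f)

  sumOver-+ : {A : Set} (xs : List A) (f g : A → Carrier) →
              sumOver xs (λ x → f x + g x) ≈ sumOver xs f + sumOver xs g
  sumOver-+ []       f g = ≈-sym (+-identityˡ _)
  sumOver-+ (x ∷ xs) f g = ≈-trans (+-congˡ (sumOver-+ xs f g)) (interchange _ _ _ _)
    where
    interchange : ∀ a b c d → (a + b) + (c + d) ≈ (a + c) + (b + d)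
    interchange = solve 4 (λ a b c d → (a :+ b) :+ (c :+ d) := (a :+ c) :+ (b :+ d)) ≈-refl

  sumOver-* : {A : Set} (xs : List A) (a : Carrier) (f : A → Carrier) →
              sumOver xs (λ x → a * f x) ≈ a * sumOver xs f
  sumOver-* []       a f = ≈-sym (zeroʳ a)
  sumOver-* (x ∷ xs) a f = ≈-trans (+-congˡ (sumOver-* xs a f)) (≈-sym (distribˡ a _ _))

  sumOver-0 : {A : Set} (xs : List A) → sumOver xs (λ _ → 0#) ≈ 0#
  sumOver-0 []       = ≈-refl
  sumOver-0 (x ∷ xs) = ≈-trans (+-identityˡ _) (sumOver-0 xs)

  sumOver-≈0 : {A : Set} (xs : List A) {f : A → Carrier} → (∀ x → f x ≈ 0#) → sumOver xs f ≈ 0#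
  sumOver-≈0 xs f≈0 = ≈-trans (sumOver-cong xs f≈0) (sumOver-0 xs)

  sumOver-swap : {A B : Set} (xs : List A) (ys : List B) (f : A → B → Carrier) →
                 sumOver xs (λ x → sumOver ys (f x)) ≈ sumOver ys (λ y → sumOver xs (λ x → f x y))
  sumOver-swap []       ys f = ≈-sym (sumOver-0 ys)
  sumOver-swap (x ∷ xs) ys f =
    ≈-trans (+-congˡ (sumOver-swap xs ys f)) (≈-sym (sumOver-+ ys (f x) (λ y → sumOver xs (λ x′ → f x′ y))))

  sumOver-filter : {A : Set} {P : A → Set} (P? : Decidable P) (xs : List A) (f : A → Carrier) →
                   sumOver (filter P? xs) f ≈ sumOver xs (λ x → ind (does (P? x)) (f x))
  sumOver-filter P? []       f = ≈-refl
  sumOver-filter P? (x ∷ xs) f with does (P? x)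
  ... | true  = +-congˡ (sumOver-filter P? xs f)
  ... | false = ≈-trans (sumOver-filter P? xs f) (≈-sym (+-identityˡ _))

  ind-0 : ∀ b → ind b 0# ≈ 0#
  ind-0 true  = ≈-refl
  ind-0 false = ≈-refl

  ind-∧ : ∀ a b x → ind (a ∧ b) x ≡ ind a (ind b x)
  ind-∧ true  b x = refl
  ind-∧ false b x = refl

  ind-+ : ∀ b x y → ind b (x + y) ≈ ind b x + ind b y
  ind-+ true  x y = ≈-refl
  ind-+ false x y = ≈-sym (+-identityˡ _)

  ind-* : ∀ b a x → ind b (a * x) ≈ a * ind b x
  ind-* true  a x = ≈-refl
  ind-* false a x = ≈-sym (zeroʳ a)

  ind-cong : ∀ b {x y} → (b ≡ true → x ≈ y) → ind b x ≈ ind b y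
  ind-cong true  x≈y = x≈y refl
  ind-cong false x≈y = ≈-refl

  ind-sumOver : {A : Set} (b : Bool) (xs : List A) (f : A → Carrier) →
                ind b (sumOver xs f) ≈ sumOver xs (λ x → ind b (f x))
  ind-sumOver true  xs f = ≈-refl
  ind-sumOver false xs f = ≈-sym (sumOver-0 xs)

  ind-split : ∀ b x → x ≈ ind b x + ind (not b) x
  ind-split true  x = ≈-sym (+-identityʳ x)
  ind-split false x = ≈-sym (+-identityˡ x)

  ind≈indicator* : ∀ b x → ind b x ≈ (if b then 1# else 0#) * x
  ind≈indicator* true  x = ≈-sym (*-identityˡ x)
  ind≈indicator* false x = ≈-sym (zeroˡ x)

  Σ-snoc : ∀ m (f : ℕ → Carrier) → Σ[1‥ suc m ] f ≈ Σ[1‥ m ] f + f (suc m)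
  Σ-snoc m f = ≈-trans (≡⇒≈ (cong (λ xs → sumOver xs f) (sym (applyUpTo-∷ʳ suc m))))
    (≈-trans (sumOver-++ (applyUpTo suc m) [ suc m ] f) (+-congˡ (+-identityʳ _)))

  Σ-cong : ∀ m {f g : ℕ → Carrier} → (∀ k → f k ≈ g k) → Σ[1‥ m ] f ≈ Σ[1‥ m ] g
  Σ-cong m = sumOver-cong (applyUpTo suc m)

  Σ-cong-range : ∀ m {f g : ℕ → Carrier} → (∀ k → 1 ≤ k → k ≤ m → f k ≈ g k) → Σ[1‥ m ] f ≈ Σ[1‥ m ] g
  Σ-cong-range zero    f≈g = ≈-refl
  Σ-cong-range (suc m) {f} {g} f≈g = begin
    Σ[1‥ suc m ] f         ≈⟨ Σ-snoc m f ⟩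
    Σ[1‥ m ] f + f (suc m) ≈⟨ +-cong (Σ-cong-range m (λ k 1≤k k≤m → f≈g k 1≤k (m≤n⇒m≤1+n k≤m)))
                                     (f≈g (suc m) (s≤s z≤n) ≤-refl) ⟩
    Σ[1‥ m ] g + g (suc m) ≈⟨ ≈-sym (Σ-snoc m g) ⟩
    Σ[1‥ suc m ] g         ∎

  Σ-+ : ∀ m (f g : ℕ → Carrier) → Σ[1‥ m ] (λ k → f k + g k) ≈ Σ[1‥ m ] f + Σ[1‥ m ] g
  Σ-+ m = sumOver-+ (applyUpTo suc m)

  Σ-* : ∀ m a (f : ℕ → Carrier) → Σ[1‥ m ] (λ k → a * f k) ≈ a * Σ[1‥ m ] f
  Σ-* m = sumOver-* (applyUpTo suc m)

  Σ-≈0 : ∀ m {f : ℕ → Carrier} → (∀ k → f k ≈ 0#) → Σ[1‥ m ] f ≈ 0#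
  Σ-≈0 m = sumOver-≈0 (applyUpTo suc m)

  Σ-≈0-range : ∀ m {f : ℕ → Carrier} → (∀ k → 1 ≤ k → k ≤ m → f k ≈ 0#) → Σ[1‥ m ] f ≈ 0#
  Σ-≈0-range m f≈0 = ≈-trans (Σ-cong-range m f≈0) (sumOver-0 (applyUpTo suc m))

  Σ-select-outside : ∀ m x (F : ℕ → Carrier) → m < x → Σ[1‥ m ] (λ l → ind (x ≡ᵇ l) (F l)) ≈ 0#
  Σ-select-outside zero    x F m<x = ≈-refl
  Σ-select-outside (suc m) x F m<x = begin
    _       ≈⟨ Σ-snoc m (λ l → ind (x ≡ᵇ l) (F l)) ⟩
    _       ≈⟨ +-cong (Σ-select-outside m x F (<-trans (n<1+n m) m<x))
                      (≡⇒≈ (cong (λ b → ind b (F (suc m))) (≢⇒≡ᵇ-false (λ e → <-irrefl (sym e) m<x)))) ⟩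
    0# + 0# ≈⟨ +-identityˡ _ ⟩
    0#      ∎

  Σ-select : ∀ m x (F : ℕ → Carrier) → 1 ≤ x → x ≤ m → Σ[1‥ m ] (λ l → ind (x ≡ᵇ l) (F l)) ≈ F x
  Σ-select zero    x F 1≤x x≤0 with () ← ≤-trans 1≤x x≤0
  Σ-select (suc m) x F 1≤x x≤m with x ≟ suc m
  ... | yes refl = begin
    _              ≈⟨ Σ-snoc m (λ l → ind (suc m ≡ᵇ l) (F l)) ⟩
    _              ≈⟨ +-cong (Σ-select-outside m (suc m) F ≤-refl)
                             (≡⇒≈ (cong (λ b → ind b (F (suc m))) (≡ᵇ-refl (suc m)))) ⟩
    0# + F (suc m) ≈⟨ +-identityˡ _ ⟩
    F (suc m)      ∎
  ... | no x≢m = begin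
    _       ≈⟨ Σ-snoc m (λ l → ind (x ≡ᵇ l) (F l)) ⟩
    _       ≈⟨ +-cong (Σ-select m x F 1≤x (≤-pred (≤∧≢⇒< x≤m x≢m)))
                      (≡⇒≈ (cong (λ b → ind b (F (suc m))) (≢⇒≡ᵇ-false x≢m))) ⟩
    F x + 0# ≈⟨ +-identityʳ _ ⟩
    F x      ∎

  Σ𝒰 : ℕ → (List ℕ → Carrier) → Carrier
  Σ𝒰 n g = sumOver (invSeqs n) (λ e → ind (avoids e) (g e))

  Σ𝒰-cong : ∀ n {g h} → (∀ e → IsInvSeq n e → avoids e ≡ true → g e ≈ h e) → Σ𝒰 n g ≈ Σ𝒰 n h
  Σ𝒰-cong n g≈h = sumOver-congᴬ (invSeqs n) (invSeqs-IsInvSeq n) λ e e-inv → ind-cong (avoids e) (g≈h e e-inv)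

  Σ𝒰-+ : ∀ n g h → Σ𝒰 n (λ e → g e + h e) ≈ Σ𝒰 n g + Σ𝒰 n h
  Σ𝒰-+ n g h = ≈-trans (sumOver-cong (invSeqs n) (λ e → ind-+ (avoids e) (g e) (h e))) (sumOver-+ (invSeqs n) _ _)

  Σ𝒰-* : ∀ n a g → Σ𝒰 n (λ e → a * g e) ≈ a * Σ𝒰 n g
  Σ𝒰-* n a g = ≈-trans (sumOver-cong (invSeqs n) (λ e → ind-* (avoids e) a (g e))) (sumOver-* (invSeqs n) a _)

  Σ𝒰-≈0 : ∀ n {g} → (∀ e → IsInvSeq n e → avoids e ≡ true → g e ≈ 0#) → Σ𝒰 n g ≈ 0#
  Σ𝒰-≈0 n g≈0 = ≈-trans (Σ𝒰-cong n g≈0) (sumOver-≈0 (invSeqs n) (λ e → ind-0 (avoids e)))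

  Σ𝒰-Σ : ∀ n m (F : ℕ → List ℕ → Carrier) →
         Σ𝒰 n (λ e → Σ[1‥ m ] (λ l → F l e)) ≈ Σ[1‥ m ] (λ l → Σ𝒰 n (F l))
  Σ𝒰-Σ n m F = ≈-trans (sumOver-cong (invSeqs n) (λ e → ind-sumOver (avoids e) (applyUpTo suc m) (λ l → F l e)))
                       (sumOver-swap (invSeqs n) (applyUpTo suc m) (λ e l → ind (avoids e) (F l e)))

  Σ𝒰-suc : ∀ m g → Σ𝒰 (suc m) g ≈ Σ𝒰 m (λ e → Σ[1‥ suc m ] (λ v → ind (not (v <ᴹ hght e)) (g (e ++ [ v ]))))
  Σ𝒰-suc m g = begin
    Σ𝒰 (suc m) g ≈⟨ sumOver-concatMap (λ e → map (λ v → e ++ [ v ]) (applyUpTo suc (suc m))) (invSeqs m) _ ⟩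
    _            ≈⟨ sumOver-cong (invSeqs m) (λ e → ≡⇒≈ (sumOver-map (λ v → e ++ [ v ]) (applyUpTo suc (suc m)) _)) ⟩
    _            ≈⟨ sumOver-cong (invSeqs m) (λ e → sumOver-cong (applyUpTo suc (suc m)) (λ v →
                      ≡⇒≈ (trans (cong (λ b → ind b (g (e ++ [ v ]))) (avoids-snoc e v)) (ind-∧ (avoids e) _ _)))) ⟩
    _            ≈⟨ sumOver-cong (invSeqs m) (λ e → ≈-sym (ind-sumOver (avoids e) (applyUpTo suc (suc m)) _)) ⟩
    _            ∎

  weight : List ℕ → Carrier
  weight e = pow q (dist e ∸ 1)

  lastHght : ℕ → ℕ → List ℕ → Bool
  lastHght l k e = (lastE e =ᴹ l) ∧ (hght e =ᴹ k)

  u≈Σ𝒰 : ∀ n i j → u n i j ≈ Σ𝒰 n (λ e → ind (lastHght i j e) (weight e))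
  u≈Σ𝒰 n i j = begin
    u n i j ≈⟨ sumOver-filter (λ e → lastHght i j e Data.Bool.≟ true) (𝒰 n) weight ⟩
    _       ≈⟨ sumOver-filter (λ e → avoids e Data.Bool.≟ true) (invSeqs n) _ ⟩
    _       ≈⟨ sumOver-cong (invSeqs n) (λ e → ≡⇒≈ (cong₂ (λ a b → ind a (ind b (weight e)))
                                                         (does-≟-true (avoids e)) (does-≟-true _))) ⟩
    _       ∎
    where
    does-≟-true : ∀ b → does (b Data.Bool.≟ true) ≡ b
    does-≟-true true  = refl
    does-≟-true false = refl

  ind-lastHght : ∀ e {x} l k W → lastE e ≡ just x → ind (lastHght l k e) W ≡ ind (x ≡ᵇ l) (ind (hght e =ᴹ k) W)
  ind-lastHght e {x} l k W lx rewrite lx = ind-∧ (x ≡ᵇ l) (hght e =ᴹ k) W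

  =ᴹ-true : ∀ m y → (m =ᴹ y) ≡ true → m ≡ just y
  =ᴹ-true (just x) y e = cong just (≡ᵇ-true⇒≡ e)

  Σ𝒰-lastHght-cong : ∀ p l k (f g : List ℕ → Carrier) →
    (∀ e → IsInvSeq p e → lastE e ≡ just l → hght e ≡ just k → f e ≈ g e) →
    Σ𝒰 p (λ e → ind (lastHght l k e) (f e)) ≈ Σ𝒰 p (λ e → ind (lastHght l k e) (g e))
  Σ𝒰-lastHght-cong p l k f g f≈g = Σ𝒰-cong p λ e e-inv _ → ind-cong (lastHght l k e) (split e e-inv)
    where
    split : ∀ e → IsInvSeq p e → lastHght l k e ≡ true → f e ≈ g e
    split e e-inv c with lastE e =ᴹ l in lx | hght e =ᴹ k in he
    split e e-inv refl | true | true = f≈g e e-inv (=ᴹ-true (lastE e) l lx) (=ᴹ-true (hght e) k he)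

  Σ𝒰-lastHght-≈0 : ∀ p l k (f : List ℕ → Carrier) →
    (∀ e → IsInvSeq p e → lastE e ≡ just l → hght e ≡ just k → f e ≈ 0#) →
    Σ𝒰 p (λ e → ind (lastHght l k e) (f e)) ≈ 0#
  Σ𝒰-lastHght-≈0 p l k f f≈0 =
    ≈-trans (Σ𝒰-lastHght-cong p l k f (λ _ → 0#) f≈0) (Σ𝒰-≈0 p (λ e _ _ → ind-0 _))

  Σ𝒰-append : ∀ m i j (g : List ℕ → Carrier) → 1 ≤ i → i ≤ suc m →
    Σ𝒰 (suc m) (λ e → ind (lastHght i j e) (g e)) ≈
    Σ𝒰 m (λ e → ind (not (i <ᴹ hght e)) (ind (hght (e ++ [ i ]) =ᴹ j) (g (e ++ [ i ]))))
  Σ𝒰-append m i j g 1≤i i≤m = ≈-trans (Σ𝒰-suc m _) (Σ𝒰-cong m λ e _ _ → ≈-trans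
    (Σ-cong (suc m) (λ v → ≡⇒≈ (
      trans (cong (λ z → ind (not (v <ᴹ hght e)) (ind ((z =ᴹ i) ∧ (hght (e ++ [ v ]) =ᴹ j)) (g (e ++ [ v ]))))
                  (last-snoc e v))
      (trans (cong (λ z → ind (not (v <ᴹ hght e)) (ind (z ∧ (hght (e ++ [ v ]) =ᴹ j)) (g (e ++ [ v ]))))
                   (≡ᵇ-sym v i))
             (ind-swap (not (v <ᴹ hght e)) (i ≡ᵇ v) _ _)))))
    (Σ-select (suc m) i (λ v → ind (not (v <ᴹ hght e)) (ind (hght (e ++ [ v ]) =ᴹ j) (g (e ++ [ v ])))) 1≤i i≤m))
    where
    ind-swap : ∀ a b c X → ind a (ind (b ∧ c) X) ≡ ind b (ind a (ind c X))
    ind-swap true  true  c X = refl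
    ind-swap true  false c X = refl
    ind-swap false true  c X = refl
    ind-swap false false c X = refl

  u-append : ∀ m i j → 1 ≤ i → i ≤ suc m →
    u (suc m) i j ≈ Σ𝒰 m (λ e → ind (not (i <ᴹ hght e)) (ind (hght (e ++ [ i ]) =ᴹ j) (weight (e ++ [ i ]))))
  u-append m i j 1≤i i≤m = ≈-trans (u≈Σ𝒰 (suc m) i j) (Σ𝒰-append m i j weight 1≤i i≤m)

  weight-snoc : ∀ e {x} v → lastE e ≡ just x → weight (e ++ [ v ]) ≡ (if v ∈ᵇ e then weight e else q * weight e)
  weight-snoc []       v ()
  weight-snoc (a ∷ as) v _ =
    trans (cong (λ d → pow q (d ∸ 1)) (dist-snoc (a ∷ as) v)) (pow-new (dist (a ∷ as) ∸ 1) (v ∈ᵇ (a ∷ as)))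
    where
    pow-new : ∀ d b → pow q (suc d +ℕ (if b then 0 else 1) ∸ 1) ≡ (if b then pow q d else q * pow q d)
    pow-new d true  rewrite ℕₚ.+-identityʳ d = refl
    pow-new d false rewrite ℕₚ.+-comm d 1    = refl

  weight-snoc-∈ : ∀ e {x} v → lastE e ≡ just x → v ∈ᵇ e ≡ true → weight (e ++ [ v ]) ≈ weight e
  weight-snoc-∈ e v lx v∈e rewrite weight-snoc e v lx | v∈e = ≈-refl

  weight-snoc-∉ : ∀ e {x} v → lastE e ≡ just x → v ∈ᵇ e ≡ false → weight (e ++ [ v ]) ≈ q * weight e
  weight-snoc-∉ e v lx v∉e rewrite weight-snoc e v lx | v∉e = ≈-refl

  step-descentFree : ∀ m e (h : List ℕ → Carrier) → IsInvSeq (suc m) e →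
    Σ[1‥ suc (suc m) ] (λ v → ind (not (v <ᴹ hght e)) (ind (is-nothing (hght (e ++ [ v ]))) (h (e ++ [ v ])))) ≈
    ind (is-nothing (hght e)) (h (ascending (suc (suc m))))
  step-descentFree m e h e-inv with IsInvSeq-last e-inv | hght e in he
  ... | x , lx , _ | just h₀ = Σ-≈0 (suc (suc m)) still-descending
    where
    still-descending : ∀ v → ind (not (v <ᴹ just h₀)) (ind (is-nothing (hght (e ++ [ v ]))) (h (e ++ [ v ]))) ≈ 0#
    still-descending v rewrite hght-snoc e v lx | he with ⊔ᴹ-just-≥ˡ h₀ (if v ≤ᵇ x then just x else nothing)
    ... | r , er , _ rewrite er = ind-0 _
  ... | x , lx , _ | nothing with hght≡nothing⇒ascending e-inv he
  ...   | refl = begin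
          _      ≈⟨ Σ-snoc (suc m) _ ⟩
          _      ≈⟨ +-congʳ (Σ-≈0-range (suc m) creates-descent) ⟩
          0# + _ ≈⟨ +-identityˡ _ ⟩
          _      ≈⟨ ≡⇒≈ (cong (λ b → ind (is-nothing b) (h (ascending (suc (suc m)))))
                               (trans (hght-ascending-snoc (suc m) (suc (suc m)) (s≤s z≤n))
                                      (cong (λ b → if b then just (suc m) else nothing) (<ᵇ-irrefl m)))) ⟩
          _      ∎
    where
    creates-descent : ∀ v → 1 ≤ v → v ≤ suc m →
                      ind (is-nothing (hght (ascending (suc m) ++ [ v ]))) (h (ascending (suc m) ++ [ v ])) ≈ 0#
    creates-descent v _ v≤m rewrite hght-ascending-snoc (suc m) v (s≤s z≤n) | ≤⇒≤ᵇ-true v≤m = ≈-refl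

  Σ𝒰-descentFree : ∀ m (h : List ℕ → Carrier) → 1 ≤ m → Σ𝒰 m (λ e → ind (is-nothing (hght e)) (h e)) ≈ h (ascending m)
  Σ𝒰-descentFree (suc zero)    h _ = +-identityʳ _
  Σ𝒰-descentFree (suc (suc m)) h _ = begin
    _ ≈⟨ Σ𝒰-suc (suc m) _ ⟩
    _ ≈⟨ Σ𝒰-cong (suc m) (λ e e-inv _ → step-descentFree m e h e-inv) ⟩
    _ ≈⟨ Σ𝒰-descentFree (suc m) (λ _ → h (ascending (suc (suc m)))) (s≤s z≤n) ⟩
    _ ∎

  -- Appending an entry above the height

  step-last>hght : ∀ (h : Maybe ℕ) x l k F → 1 ≤ x → k < l →
    ind (not (l <ᴹ h)) (ind (hghtAfter h x l =ᴹ k) F) ≈ Σ[1‥ l ∸ 1 ] (λ l′ → ind ((x ≡ᵇ l′) ∧ (h =ᴹ k)) F)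
  step-last>hght h x l k F 1≤x k<l with l ≤ᵇ x in l≤x
  ... | true with ⊔ᴹ-just-≥ʳ h x
  ...   | r , er , x≤r
    rewrite er | ≢⇒≡ᵇ-false {r} {k} (λ r≡k → <-irrefl refl (≤-trans k<l (≤-trans (≤ᵇ-true⇒≤ l≤x) (subst (x ≤_) r≡k x≤r)))) =
    ≈-trans (ind-0 _) (≈-sym (≈-trans (Σ-cong (l ∸ 1) (λ l′ → ≡⇒≈ (ind-∧ (x ≡ᵇ l′) (h =ᴹ k) F)))
                                      (Σ-select-outside (l ∸ 1) x _ (pred-< {x} {l} 1≤x (≤ᵇ-true⇒≤ l≤x)))))
  step-last>hght h x l k F 1≤x k<l | false rewrite ⊔ᴹ-identityʳ h =
    ≈-sym (≈-trans (Σ-cong (l ∸ 1) (λ l′ → ≡⇒≈ (ind-∧ (x ≡ᵇ l′) (h =ᴹ k) F)))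
                   (≈-trans (Σ-select (l ∸ 1) x _ 1≤x (<⇒≤pred {x} {l} (≤ᵇ-false⇒> l≤x))) (not-below h)))
    where
    not-below : ∀ h → ind (h =ᴹ k) F ≈ ind (not (l <ᴹ h)) (ind (h =ᴹ k) F)
    not-below nothing   = ≈-refl
    not-below (just h₀) with h₀ ≡ᵇ k in h₀≡k
    ... | false = ≈-sym (ind-0 _)
    ... | true rewrite ≡ᵇ-true⇒≡ {h₀} {k} h₀≡k | ≥⇒<ᵇ-false {l} {k} (<⇒≤ k<l) = ≈-refl

  Σ𝒰-append-above-hght : ∀ p k l (f : List ℕ → Carrier) → 1 ≤ p → k < l → 1 ≤ l → l ≤ suc p →
    Σ𝒰 (suc p) (λ e → ind (lastHght l k e) (f e)) ≈
    Σ[1‥ l ∸ 1 ] (λ l′ → Σ𝒰 p (λ e → ind (lastHght l′ k e) (f (e ++ [ l ]))))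
  Σ𝒰-append-above-hght (suc p) k l f _ k<l 1≤l l≤p = ≈-trans (Σ𝒰-append (suc p) l k f 1≤l l≤p)
    (≈-trans (Σ𝒰-cong (suc p) (λ e e-inv _ → step e e-inv))
             (Σ𝒰-Σ (suc p) (l ∸ 1) (λ l′ e → ind (lastHght l′ k e) (f (e ++ [ l ])))))
    where
    step : ∀ e → IsInvSeq (suc p) e →
      ind (not (l <ᴹ hght e)) (ind (hght (e ++ [ l ]) =ᴹ k) (f (e ++ [ l ]))) ≈
      Σ[1‥ l ∸ 1 ] (λ l′ → ind (lastHght l′ k e) (f (e ++ [ l ])))
    step e e-inv with IsInvSeq-last e-inv
    ... | x , lx , 1≤x , _ rewrite hght-snoc e l lx | lx = step-last>hght (hght e) x l k (f (e ++ [ l ])) 1≤x k<l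

  Σ𝒰-append-new : ∀ p k l (f g : List ℕ → Carrier) → 1 ≤ p → k < l → 1 ≤ l → l ≤ suc p →
    (∀ e {x} → lastE e ≡ just x → l ∈ᵇ e ≡ false → f (e ++ [ l ]) ≈ q * g e) →
    Σ𝒰 (suc p) (λ e → ind (lastHght l k e) (f e)) ≈ q * Σ[1‥ l ∸ 1 ] (λ l′ → Σ𝒰 p (λ e → ind (lastHght l′ k e) (g e)))
  Σ𝒰-append-new p k l f g 1≤p k<l 1≤l l≤p f≈qg = begin
    _ ≈⟨ Σ𝒰-append-above-hght p k l f 1≤p k<l 1≤l l≤p ⟩
    _ ≈⟨ Σ-cong-range (l ∸ 1) (λ l′ _ l′≤l → ≈-trans
           (Σ𝒰-lastHght-cong p l′ k _ (λ e → q * g e) (λ e e-inv lx he →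
             f≈qg e lx (∉ᵇ-above-last-and-hght e-inv lx he (≤pred⇒< 1≤l l′≤l) k<l)))
           (≈-trans (Σ𝒰-cong p (λ e _ _ → ind-* (lastHght l′ k e) q (g e))) (Σ𝒰-* p q _))) ⟩
    _ ≈⟨ Σ-* (l ∸ 1) q _ ⟩
    _ ∎

  u-last>hght : ∀ n i j → 3 ≤ n → 1 ≤ j → j < i → i ≤ n → u n i j ≈ q * Σ[1‥ i ∸ 1 ] (λ l → u (n ∸ 1) l j)
  u-last>hght (suc p) i j (s≤s (s≤s _)) 1≤j j<i i≤p = begin
    u (suc p) i j ≈⟨ u≈Σ𝒰 (suc p) i j ⟩
    _             ≈⟨ Σ𝒰-append-new p j i weight weight (s≤s z≤n) j<i (≤-trans 1≤j (<⇒≤ j<i)) i≤p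
                       (λ e lx i∉e → weight-snoc-∉ e i lx i∉e) ⟩
    _             ≈⟨ *-congˡ (Σ-cong (i ∸ 1) (λ l → ≈-sym (u≈Σ𝒰 p l j))) ⟩
    _             ∎

  u-hght≡length : ∀ p l → u p l p ≈ 0#
  u-hght≡length p l = ≈-trans (u≈Σ𝒰 p l p)
    (Σ𝒰-lastHght-≈0 p l p weight (λ e e-inv _ he → ⊥-elim (<-irrefl refl (proj₂ (hght-range e-inv he)))))

  -- Appending an entry equal to the height

  step-last≡hght : ∀ (h : Maybe ℕ) x i (W W′ : Carrier) → 1 ≤ x → 1 ≤ i →
    (h ≡ just i → W′ ≈ W) → (x ≡ i → W′ ≈ W) → (h ≡ nothing → x ≢ i) → (∀ h₀ → h ≡ just h₀ → 1 ≤ h₀) →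
    ind (not (i <ᴹ h)) (ind (hghtAfter h x i =ᴹ i) W′) ≈
    ind (x ≡ᵇ i) (Σ[1‥ i ∸ 1 ] (λ k → ind (h =ᴹ k) W)) + Σ[1‥ i ] (λ l → ind (x ≡ᵇ l) (ind (h =ᴹ i) W))
  step-last≡hght h x i W W′ 1≤x 1≤i h≡i⇒W x≡i⇒W ascending⇒x≢i 1≤h with <-cmp x i
  ... | tri< x<i _ _ rewrite >⇒≤ᵇ-false {i} {x} x<i | ⊔ᴹ-identityʳ h | ≢⇒≡ᵇ-false {x} {i} (<⇒≢ x<i) =
    ≈-sym (≈-trans (+-identityˡ _) (≈-trans (Σ-select i x _ 1≤x (<⇒≤ x<i)) (not-below h h≡i⇒W)))
    where
    not-below : ∀ h → (h ≡ just i → W′ ≈ W) → ind (h =ᴹ i) W ≈ ind (not (i <ᴹ h)) (ind (h =ᴹ i) W′)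
    not-below nothing   _     = ≈-refl
    not-below (just h₀) h≡i⇒W with h₀ ≡ᵇ i in h₀≡i
    ... | false = ≈-sym (ind-0 _)
    ... | true rewrite ≡ᵇ-true⇒≡ {h₀} {i} h₀≡i | <ᵇ-irrefl i = ≈-sym (h≡i⇒W refl)
  ... | tri> _ _ i<x with ⊔ᴹ-just-≥ʳ h x
  ...   | r , er , x≤r rewrite ≤⇒≤ᵇ-true {i} {x} (<⇒≤ i<x) | er
                             | ≢⇒≡ᵇ-false {r} {i} (λ r≡i → <-irrefl (sym r≡i) (<-≤-trans i<x x≤r))
                             | ≢⇒≡ᵇ-false {x} {i} (λ x≡i → <-irrefl (sym x≡i) i<x) =
    ≈-trans (ind-0 _) (≈-sym (≈-trans (+-identityˡ _) (Σ-select-outside i x _ i<x)))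
  step-last≡hght nothing   x i W W′ 1≤x 1≤i h≡i⇒W x≡i⇒W ascending⇒x≢i 1≤h | tri≈ _ refl _ =
    ⊥-elim (ascending⇒x≢i refl refl)
  step-last≡hght (just h₀) x i W W′ 1≤x 1≤i h≡i⇒W x≡i⇒W ascending⇒x≢i 1≤h | tri≈ _ refl _
    rewrite ≤⇒≤ᵇ-true {x} {x} ≤-refl | ≡ᵇ-refl x with <-cmp h₀ x
  ... | tri< h<x _ _ rewrite m≤n⇒m⊔n≡n (<⇒≤ h<x) | ≡ᵇ-refl x | ≥⇒<ᵇ-false {x} {h₀} (<⇒≤ h<x)
                           | ≢⇒≡ᵇ-false {h₀} {x} (<⇒≢ h<x) =
    ≈-sym (≈-trans (+-cong (Σ-select (x ∸ 1) h₀ _ (1≤h h₀ refl) (<⇒≤pred h<x)) (Σ-select x x _ 1≤x ≤-refl))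
                   (≈-trans (+-identityʳ _) (≈-sym (x≡i⇒W refl))))
  ... | tri≈ _ refl _ rewrite ⊔-idem h₀ | ≡ᵇ-refl h₀ | <ᵇ-irrefl h₀ =
    ≈-sym (≈-trans (+-cong (Σ-select-outside (h₀ ∸ 1) h₀ _ (pred-< 1≤x ≤-refl)) (Σ-select h₀ h₀ _ 1≤x ≤-refl))
                   (≈-trans (+-identityˡ _) (≈-sym (x≡i⇒W refl))))
  ... | tri> _ _ x<h rewrite <⇒<ᵇ-true x<h | ≢⇒≡ᵇ-false {h₀} {x} (λ h≡x → <-irrefl (sym h≡x) x<h) =
    ≈-sym (≈-trans (+-cong (Σ-select-outside (x ∸ 1) h₀ _ (≤-trans (pred-< {x} {x} 1≤x ≤-refl) (<⇒≤ x<h)))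
                           (Σ-select x x _ 1≤x ≤-refl))
                   (+-identityˡ _))

  u-last≡hght : ∀ n i → 3 ≤ n → 1 ≤ i → i ≤ n ∸ 2 →
    u n i i ≈ Σ[1‥ i ∸ 1 ] (λ k → u (n ∸ 1) i k) + Σ[1‥ i ] (λ l → u (n ∸ 1) l i)
  u-last≡hght (suc m) i (s≤s (s≤s _)) 1≤i i≤m = begin
    u (suc m) i i ≈⟨ u-append m i i 1≤i (≤-trans (≤-trans i≤m (m∸n≤m m 1)) (n≤1+n m)) ⟩
    _             ≈⟨ Σ𝒰-cong m (λ e e-inv _ → step e e-inv) ⟩
    _             ≈⟨ Σ𝒰-+ m _ _ ⟩
    _             ≈⟨ +-cong (Σ𝒰-Σ m (i ∸ 1) (λ k e → ind (lastHght i k e) (weight e)))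
                            (Σ𝒰-Σ m i (λ l e → ind (lastHght l i e) (weight e))) ⟩
    _             ≈⟨ ≈-sym (+-cong (Σ-cong (i ∸ 1) (λ k → u≈Σ𝒰 m i k)) (Σ-cong i (λ l → u≈Σ𝒰 m l i))) ⟩
    _             ∎
    where
    step : ∀ e → IsInvSeq m e → ind (not (i <ᴹ hght e)) (ind (hght (e ++ [ i ]) =ᴹ i) (weight (e ++ [ i ]))) ≈
           Σ[1‥ i ∸ 1 ] (λ k → ind (lastHght i k e) (weight e)) + Σ[1‥ i ] (λ l → ind (lastHght l i e) (weight e))
    step e e-inv with IsInvSeq-last e-inv
    ... | x , lx , 1≤x , _ rewrite hght-snoc e i lx =
      ≈-trans (step-last≡hght (hght e) x i (weight e) (weight (e ++ [ i ])) 1≤x 1≤i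
                 (λ he → weight-snoc-∈ e i lx (hght-∈ᵇ e-inv he))
                 (λ { refl → weight-snoc-∈ e x lx (last⇒∈ᵇ e lx) })
                 (λ he x≡i → <-irrefl (trans (sym x≡i) (last-of-ascending he)) (≤pred⇒< (s≤s z≤n) i≤m))
                 (λ h₀ he → proj₁ (hght-range e-inv he)))
              (≈-sym (+-cong (≈-trans (Σ-cong (i ∸ 1) (λ k → ≡⇒≈ (ind-lastHght e i k (weight e) lx)))
                                      (≈-sym (ind-sumOver (x ≡ᵇ i) (applyUpTo suc (i ∸ 1)) _)))
                             (Σ-cong i (λ l → ≡⇒≈ (ind-lastHght e l i (weight e) lx)))))
      where
      last-of-ascending : hght e ≡ nothing → x ≡ m
      last-of-ascending he = just-injective (trans (sym lx) (trans (cong lastE (hght≡nothing⇒ascending e-inv he))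
                                                                   (last-ascending m (s≤s z≤n))))

  -- Appending the largest possible height

  step-top : ∀ (h : Maybe ℕ) x m (W W′ : Carrier) → x ≤ m →
    (∀ h₀ → h ≡ just h₀ → 1 ≤ h₀ × h₀ < m) → (x ≡ m → W′ ≈ W) →
    ind (not (m <ᴹ h)) (ind (hghtAfter h x m =ᴹ m) W′) ≈
    ind (is-nothing h) (ind (x ≡ᵇ m) W) + Σ[1‥ m ∸ 1 ] (λ k → ind ((x ≡ᵇ m) ∧ (h =ᴹ k)) W)
  step-top h x m W W′ x≤m h-range x≡m⇒W with <-cmp x m
  ... | tri> _ _ m<x = ⊥-elim (<⇒≱ m<x x≤m)
  ... | tri< x<m _ _ rewrite >⇒≤ᵇ-false {m} {x} x<m | ⊔ᴹ-identityʳ h | ≢⇒≡ᵇ-false {x} {m} (<⇒≢ x<m) =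
    ≈-trans (hght-below h h-range) (≈-sym (≈-trans (+-cong (ind-0 (is-nothing h)) (sumOver-0 (applyUpTo suc (m ∸ 1))))
                                                   (+-identityʳ _)))
    where
    hght-below : ∀ h → (∀ h₀ → h ≡ just h₀ → 1 ≤ h₀ × h₀ < m) → ind (not (m <ᴹ h)) (ind (h =ᴹ m) W′) ≈ 0#
    hght-below nothing   _       = ≈-refl
    hght-below (just h₀) h-range rewrite ≢⇒≡ᵇ-false {h₀} {m} (<⇒≢ (proj₂ (h-range h₀ refl))) = ind-0 _
  step-top nothing x m W W′ x≤m h-range x≡m⇒W | tri≈ _ refl _ rewrite ≤⇒≤ᵇ-true {x} {x} ≤-refl | ≡ᵇ-refl x =
    ≈-trans (x≡m⇒W refl) (≈-sym (≈-trans (+-congˡ (sumOver-0 (applyUpTo suc (x ∸ 1)))) (+-identityʳ _)))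
  step-top (just h₀) x m W W′ x≤m h-range x≡m⇒W | tri≈ _ refl _
    rewrite ≤⇒≤ᵇ-true {x} {x} ≤-refl | ≡ᵇ-refl x | m≤n⇒m⊔n≡n (<⇒≤ (proj₂ (h-range h₀ refl))) | ≡ᵇ-refl x
          | ≥⇒<ᵇ-false {x} {h₀} (<⇒≤ (proj₂ (h-range h₀ refl))) =
    ≈-trans (x≡m⇒W refl) (≈-sym (≈-trans (+-identityˡ _) (Σ-select (x ∸ 1) h₀ _ (proj₁ (h-range h₀ refl))
                                                                  (<⇒≤pred (proj₂ (h-range h₀ refl))))))

  u-top : ∀ n → 4 ≤ n →
    u n (n ∸ 1) (n ∸ 1) ≈ pow q (n ∸ 2) + q * Σ[1‥ n ∸ 2 ] (λ i → Σ[1‥ n ∸ 3 ] (λ j → u (n ∸ 2) i j))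
  u-top (suc (suc (suc (suc r)))) (s≤s (s≤s (s≤s (s≤s _)))) = begin
    u (suc m) m m ≈⟨ u-append m m m (s≤s z≤n) (n≤1+n m) ⟩
    _ ≈⟨ Σ𝒰-cong m (λ e e-inv _ → step e e-inv) ⟩
    _ ≈⟨ Σ𝒰-+ m _ _ ⟩
    _ ≈⟨ +-cong (Σ𝒰-descentFree m (λ e → ind (lastE e =ᴹ m) (weight e)) (s≤s z≤n))
                (Σ𝒰-Σ m p (λ k e → ind (lastHght m k e) (weight e))) ⟩
    _ ≈⟨ +-cong (≡⇒≈ weight-ascending)
                (Σ-cong-range p (λ k 1≤k k≤p → ≈-trans (≈-sym (u≈Σ𝒰 m m k))
                                                      (u-last>hght m m k (s≤s (s≤s (s≤s z≤n))) 1≤k (s≤s k≤p) ≤-refl))) ⟩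
    _ ≈⟨ +-congˡ (Σ-* p q _) ⟩
    _ ≈⟨ +-congˡ (*-congˡ (sumOver-swap (applyUpTo suc p) (applyUpTo suc p) (λ k l → u p l k))) ⟩
    _ ≈⟨ +-congˡ (*-congˡ (Σ-cong p (λ l → ≈-trans (Σ-snoc (suc r) (λ k → u p l k))
                                                  (≈-trans (+-congˡ (u-hght≡length p l)) (+-identityʳ _))))) ⟩
    _ ∎
    where
    p = suc (suc r)
    m = suc p
    weight-ascending : ind (lastE (ascending m) =ᴹ m) (weight (ascending m)) ≡ pow q p
    weight-ascending rewrite last-ascending m (s≤s z≤n) | ≡ᵇ-refl m | dist-ascending m = refl
    step : ∀ e → IsInvSeq m e → ind (not (m <ᴹ hght e)) (ind (hght (e ++ [ m ]) =ᴹ m) (weight (e ++ [ m ]))) ≈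
           ind (is-nothing (hght e)) (ind (lastE e =ᴹ m) (weight e)) + Σ[1‥ p ] (λ k → ind (lastHght m k e) (weight e))
    step e e-inv with IsInvSeq-last e-inv
    ... | x , lx , _ , x≤m rewrite hght-snoc e m lx | lx =
      step-top (hght e) x m (weight e) (weight (e ++ [ m ])) x≤m (λ _ → hght-range e-inv)
               (λ { refl → weight-snoc-∈ e x lx (last⇒∈ᵇ e lx) })

  -- Appending an entry below the height

  module SplitByValue (k i₁ : ℕ) (1≤k : 1 ≤ k) (k<i : k < suc i₁) where
    i : ℕ
    i = suc i₁

    uₖ uₖ∋i uₖ∌i : ℕ → ℕ → Carrier
    uₖ   p l = Σ𝒰 p (λ e → ind (lastHght l k e) (weight e))
    uₖ∋i p l = Σ𝒰 p (λ e → ind (lastHght l k e) (ind (i ∈ᵇ e) (weight e)))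
    uₖ∌i p l = Σ𝒰 p (λ e → ind (lastHght l k e) (ind (not (i ∈ᵇ e)) (weight e)))

    uₖ≈∋+∌ : ∀ p l → uₖ p l ≈ uₖ∋i p l + uₖ∌i p l
    uₖ≈∋+∌ p l = ≈-trans (Σ𝒰-cong p (λ e _ _ → ≈-trans (ind-cong (lastHght l k e) (λ _ → ind-split (i ∈ᵇ e) (weight e)))
                                                       (ind-+ (lastHght l k e) _ _)))
                         (Σ𝒰-+ p _ _)

    uₖ∋i-below≈0 : ∀ p l → l < i → uₖ∋i p l ≈ 0#
    uₖ∋i-below≈0 p l l<i = Σ𝒰-lastHght-≈0 p l k _ (λ e e-inv lx he →
      ≡⇒≈ (cong (λ b → ind b (weight e)) (∉ᵇ-above-last-and-hght e-inv lx he l<i k<i)))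

    uₖ∌i-at-i≈0 : ∀ p → uₖ∌i p i ≈ 0#
    uₖ∌i-at-i≈0 p = Σ𝒰-lastHght-≈0 p i k _ (λ e _ lx _ → ≡⇒≈ (cong (λ b → ind (not b) (weight e)) (last⇒∈ᵇ e lx)))

    uₖ∌i-below : ∀ p l → l < i → uₖ∌i p l ≈ uₖ p l
    uₖ∌i-below p l l<i = Σ𝒰-lastHght-cong p l k _ _ (λ e e-inv lx he →
      ≡⇒≈ (cong (λ b → ind (not b) (weight e)) (∉ᵇ-above-last-and-hght e-inv lx he l<i k<i)))

    uₖ∋i-suc : ∀ p l → 1 ≤ p → k < l → l ≤ suc p → l ≢ i → uₖ∋i (suc p) l ≈ q * Σ[1‥ l ∸ 1 ] (uₖ∋i p)
    uₖ∋i-suc p l 1≤p k<l l≤p l≢i = Σ𝒰-append-new p k l _ _ 1≤p k<l (≤-trans (s≤s z≤n) k<l) l≤p (λ e lx l∉e →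
      ≈-trans (≡⇒≈ (cong (λ b → ind b (weight (e ++ [ l ]))) (∈ᵇ-snoc-≢ i e l≢i)))
              (≈-trans (ind-cong (i ∈ᵇ e) (λ _ → weight-snoc-∉ e l lx l∉e)) (ind-* (i ∈ᵇ e) q (weight e))))

    uₖ∌i-suc : ∀ p l → 1 ≤ p → k < l → l ≤ suc p → l ≢ i → uₖ∌i (suc p) l ≈ q * Σ[1‥ l ∸ 1 ] (uₖ∌i p)
    uₖ∌i-suc p l 1≤p k<l l≤p l≢i = Σ𝒰-append-new p k l _ _ 1≤p k<l (≤-trans (s≤s z≤n) k<l) l≤p (λ e lx l∉e →
      ≈-trans (≡⇒≈ (cong (λ b → ind (not b) (weight (e ++ [ l ]))) (∈ᵇ-snoc-≢ i e l≢i)))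
              (≈-trans (ind-cong (not (i ∈ᵇ e)) (λ _ → weight-snoc-∉ e l lx l∉e)) (ind-* (not (i ∈ᵇ e)) q (weight e))))

    uₖ-suc : ∀ p l → 1 ≤ p → k < l → l ≤ suc p → uₖ (suc p) l ≈ q * Σ[1‥ l ∸ 1 ] (uₖ p)
    uₖ-suc p l 1≤p k<l l≤p = Σ𝒰-append-new p k l weight weight 1≤p k<l (≤-trans (s≤s z≤n) k<l) l≤p
      (λ e lx l∉e → weight-snoc-∉ e l lx l∉e)

    uₖ∋i-suc-at-i : ∀ p → 1 ≤ p → i ≤ suc p → uₖ∋i (suc p) i ≈ q * Σ[1‥ i₁ ] (uₖ p)
    uₖ∋i-suc-at-i p 1≤p i≤p = Σ𝒰-append-new p k i _ weight 1≤p k<i (s≤s z≤n) i≤p (λ e lx i∉e →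
      ≈-trans (≡⇒≈ (cong (λ b → ind b (weight (e ++ [ i ]))) (∈ᵇ-snoc-≡ i e))) (weight-snoc-∉ e i lx i∉e))

    ∌+∋-at-i : ∀ p → 1 ≤ p → i ≤ suc p → uₖ∌i (suc p) i + uₖ∋i (suc p) i ≈ q * Σ[1‥ i ] (uₖ∌i p)
    ∌+∋-at-i p 1≤p i≤p = begin
      uₖ∌i (suc p) i + uₖ∋i (suc p) i ≈⟨ +-cong (uₖ∌i-at-i≈0 (suc p)) (uₖ∋i-suc-at-i p 1≤p i≤p) ⟩
      0# + q * Σ[1‥ i₁ ] (uₖ p)        ≈⟨ +-identityˡ _ ⟩
      q * Σ[1‥ i₁ ] (uₖ p)             ≈⟨ *-congˡ (≈-sym (≈-trans (Σ-snoc i₁ (uₖ∌i p))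
                                           (≈-trans (+-cong (Σ-cong-range i₁ (λ l _ l≤i₁ → uₖ∌i-below p l (s≤s l≤i₁)))
                                                            (uₖ∌i-at-i≈0 p))
                                                    (+-identityʳ _)))) ⟩
      q * Σ[1‥ i ] (uₖ∌i p)            ∎

    ∌+∋-above-i : ∀ p l → 1 ≤ p → k < suc l → suc l ≤ suc p → suc l ≢ i →
      Σ[1‥ l ] (uₖ∋i p) ≈ uₖ∌i p (suc l) →
      uₖ∌i (suc p) (suc l) + uₖ∋i (suc p) (suc l) ≈ q * Σ[1‥ suc l ] (uₖ∌i p)
    ∌+∋-above-i p l 1≤p k<l l≤p l≢i Σ∋≈∌ = begin
      uₖ∌i (suc p) (suc l) + uₖ∋i (suc p) (suc l)      ≈⟨ +-cong (uₖ∌i-suc p (suc l) 1≤p k<l l≤p l≢i)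
                                                                 (uₖ∋i-suc p (suc l) 1≤p k<l l≤p l≢i) ⟩
      q * Σ[1‥ l ] (uₖ∌i p) + q * Σ[1‥ l ] (uₖ∋i p)    ≈⟨ +-congˡ (*-congˡ Σ∋≈∌) ⟩
      q * Σ[1‥ l ] (uₖ∌i p) + q * uₖ∌i p (suc l)       ≈⟨ ≈-sym (distribˡ q _ _) ⟩
      q * (Σ[1‥ l ] (uₖ∌i p) + uₖ∌i p (suc l))         ≈⟨ *-congˡ (≈-sym (Σ-snoc l (uₖ∌i p))) ⟩
      q * Σ[1‥ suc l ] (uₖ∌i p)                        ∎

    Σuₖ∋i≈uₖ∌i-suc : ∀ p → 1 ≤ p → (∀ l → i ≤ l → l ≤ p → Σ[1‥ l ∸ 1 ] (uₖ∋i p) ≈ uₖ∌i p l) →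
                     ∀ l → i ≤ l → l ≤ suc p → Σ[1‥ l ∸ 1 ] (uₖ∋i (suc p)) ≈ uₖ∌i (suc p) l
    Σuₖ∋i≈uₖ∌i-suc p 1≤p IH l i≤l l≤p with i ≟ l
    ... | yes refl = ≈-trans (Σ-≈0-range i₁ (λ l′ _ l′≤i₁ → uₖ∋i-below≈0 (suc p) l′ (s≤s l′≤i₁)))
                             (≈-sym (uₖ∌i-at-i≈0 (suc p)))
    Σuₖ∋i≈uₖ∌i-suc p 1≤p IH (suc zero) i≤1 l≤p | no i≢1
      with () ← ≤-trans (s≤s 1≤k) (≤-trans k<i (≤-pred (≤∧≢⇒< i≤1 i≢1)))
    Σuₖ∋i≈uₖ∌i-suc p 1≤p IH (suc (suc l)) i≤l l≤p | no i≢l = begin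
      Σ[1‥ suc l ] (uₖ∋i (suc p))
        ≈⟨ Σ-snoc l (uₖ∋i (suc p)) ⟩
      Σ[1‥ l ] (uₖ∋i (suc p)) + uₖ∋i (suc p) (suc l)
        ≈⟨ +-congʳ (Σuₖ∋i≈uₖ∌i-suc p 1≤p IH (suc l) i≤l′ (≤-trans (n≤1+n _) l≤p)) ⟩
      uₖ∌i (suc p) (suc l) + uₖ∋i (suc p) (suc l)
        ≈⟨ step (i ≟ suc l) ⟩
      q * Σ[1‥ suc l ] (uₖ∌i p)
        ≈⟨ ≈-sym (uₖ∌i-suc p (suc (suc l)) 1≤p (≤-trans k<i i≤l) l≤p (λ e → i≢l (sym e))) ⟩
      uₖ∌i (suc p) (suc (suc l)) ∎
      where
      i≤l′ : i ≤ suc l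
      i≤l′ = ≤-pred (≤∧≢⇒< i≤l i≢l)
      step : Dec (i ≡ suc l) → uₖ∌i (suc p) (suc l) + uₖ∋i (suc p) (suc l) ≈ q * Σ[1‥ suc l ] (uₖ∌i p)
      step (yes refl) = ∌+∋-at-i p 1≤p (≤-trans i≤l′ (≤-trans (n≤1+n _) l≤p))
      step (no i≢l′)  = ∌+∋-above-i p l 1≤p (≤-trans k<i i≤l′) (≤-trans (n≤1+n _) l≤p)
                          (λ e → i≢l′ (sym e)) (IH (suc l) i≤l′ (≤-pred l≤p))

    -- Induction on p: for l > i both uₖ∋i and uₖ∌i satisfy X (p + 1) l = q · Σ_{l' < l} X p l',
    -- while uₖ∌i (p + 1) i = 0 and uₖ∋i (p + 1) i = q · Σ_{l' < i} uₖ p l'.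
    Σuₖ∋i≈uₖ∌i : ∀ p l → i ≤ l → l ≤ p → Σ[1‥ l ∸ 1 ] (uₖ∋i p) ≈ uₖ∌i p l
    Σuₖ∋i≈uₖ∌i zero          l i≤l l≤0 with () ← ≤-trans i≤l l≤0
    Σuₖ∋i≈uₖ∌i (suc zero)    l i≤l l≤1 with s≤s () ← ≤-trans (s≤s 1≤k) (≤-trans k<i (≤-trans i≤l l≤1))
    Σuₖ∋i≈uₖ∌i (suc (suc p)) = Σuₖ∋i≈uₖ∌i-suc (suc p) (s≤s z≤n) (Σuₖ∋i≈uₖ∌i (suc p))

    Σ𝒰-weight-snoc-i : ∀ p j₁ → 1 ≤ p → i ≤ j₁ → j₁ ≤ p →
      Σ𝒰 (suc p) (λ e → ind (lastHght (suc j₁) k e) (weight (e ++ [ i ]))) ≈ q * (u p j₁ k + u (suc p) j₁ k)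
    Σ𝒰-weight-snoc-i p (suc j₂) 1≤p i≤j₁ j₁≤p = begin
      Σ𝒰 (suc p) (λ e → ind (lastHght j k e) (weight (e ++ [ i ])))
        ≈⟨ Σ𝒰-lastHght-cong (suc p) j k _ (λ e → ind (i ∈ᵇ e) (weight e) + q * ind (not (i ∈ᵇ e)) (weight e))
             (λ e _ lx _ → ≈-trans (≡⇒≈ (weight-snoc e i lx)) (if-split (i ∈ᵇ e) (weight e))) ⟩
      Σ𝒰 (suc p) (λ e → ind (lastHght j k e) (ind (i ∈ᵇ e) (weight e) + q * ind (not (i ∈ᵇ e)) (weight e)))
        ≈⟨ Σ𝒰-cong (suc p) (λ e _ _ → ≈-trans (ind-+ (lastHght j k e) _ _) (+-congˡ (ind-* (lastHght j k e) q _))) ⟩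
      _ ≈⟨ ≈-trans (Σ𝒰-+ (suc p) _ _) (+-congˡ (Σ𝒰-* (suc p) q _)) ⟩
      uₖ∋i (suc p) j + q * uₖ∌i (suc p) j
        ≈⟨ +-cong (uₖ∋i-suc p j 1≤p k<j (s≤s j₁≤p) j≢i) (*-congˡ (uₖ∌i-suc p j 1≤p k<j (s≤s j₁≤p) j≢i)) ⟩
      q * Σ[1‥ j₁ ] (uₖ∋i p) + q * (q * Σ[1‥ j₁ ] (uₖ∌i p))
        ≈⟨ +-cong (*-congˡ (Σ-snoc j₂ (uₖ∋i p))) (*-congˡ (*-congˡ (Σ-snoc j₂ (uₖ∌i p)))) ⟩
      q * (Σ[1‥ j₂ ] (uₖ∋i p) + uₖ∋i p j₁) + q * (q * (Σ[1‥ j₂ ] (uₖ∌i p) + uₖ∌i p j₁))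
        ≈⟨ +-congʳ (*-congˡ (+-congʳ (Σuₖ∋i≈uₖ∌i p j₁ i≤j₁ j₁≤p))) ⟩
      q * (uₖ∌i p j₁ + uₖ∋i p j₁) + q * (q * (Σ[1‥ j₂ ] (uₖ∌i p) + uₖ∌i p j₁))
        ≈⟨ regroup (uₖ∋i p j₁) (uₖ∌i p j₁) (Σ[1‥ j₂ ] (uₖ∌i p)) ⟩
      q * ((uₖ∋i p j₁ + uₖ∌i p j₁) + q * (uₖ∌i p j₁ + Σ[1‥ j₂ ] (uₖ∌i p)))
        ≈⟨ *-congˡ (+-cong (≈-sym (uₖ≈∋+∌ p j₁)) (*-congˡ (+-congʳ (≈-sym (Σuₖ∋i≈uₖ∌i p j₁ i≤j₁ j₁≤p))))) ⟩
      q * (uₖ p j₁ + q * (Σ[1‥ j₂ ] (uₖ∋i p) + Σ[1‥ j₂ ] (uₖ∌i p)))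
        ≈⟨ *-congˡ (+-congˡ (*-congˡ (≈-sym (≈-trans (Σ-cong j₂ (uₖ≈∋+∌ p)) (Σ-+ j₂ (uₖ∋i p) (uₖ∌i p)))))) ⟩
      q * (uₖ p j₁ + q * Σ[1‥ j₂ ] (uₖ p))
        ≈⟨ *-congˡ (+-congˡ (≈-sym (uₖ-suc p j₁ 1≤p (≤-trans k<i i≤j₁) (≤-trans j₁≤p (n≤1+n p))))) ⟩
      q * (uₖ p j₁ + uₖ (suc p) j₁)
        ≈⟨ *-congˡ (≈-sym (+-cong (u≈Σ𝒰 p j₁ k) (u≈Σ𝒰 (suc p) j₁ k))) ⟩
      q * (u p j₁ k + u (suc p) j₁ k) ∎
      where
      j₁ = suc j₂
      j = suc j₁
      k<j : k < j
      k<j = ≤-trans k<i (≤-trans i≤j₁ (n≤1+n j₁))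
      j≢i : j ≢ i
      j≢i j≡i = <-irrefl (sym j≡i) (s≤s i≤j₁)
      if-split : ∀ b W → (if b then W else q * W) ≈ ind b W + q * ind (not b) W
      if-split true  W = ≈-sym (≈-trans (+-congˡ (zeroʳ q)) (+-identityʳ _))
      if-split false W = ≈-sym (+-identityˡ _)
      regroup : ∀ a b s → q * (b + a) + q * (q * (s + b)) ≈ q * ((a + b) + q * (b + s))
      regroup = solve 4 (λ q a b s → q :* (b :+ a) :+ q :* (q :* (s :+ b)) := q :* ((a :+ b) :+ q :* (b :+ s))) ≈-refl q

  step-last<hght : ∀ (h : Maybe ℕ) x i j (W W′ : Carrier) → 1 ≤ x → i < j →
    (h ≡ nothing → W′ ≈ W) → (h ≡ just i → W′ ≈ W) → (∀ h₀ → h ≡ just h₀ → 1 ≤ h₀) →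
    ind (not (i <ᴹ h)) (ind (hghtAfter h x i =ᴹ j) W′) ≈
    (ind (is-nothing h) (ind (x ≡ᵇ j) W) + ind ((x ≡ᵇ j) ∧ (h =ᴹ i)) W)
    + Σ[1‥ i ∸ 1 ] (λ k → ind ((x ≡ᵇ j) ∧ (h =ᴹ k)) W′)
  step-last<hght h x i j W W′ 1≤x i<j ascending⇒W h≡i⇒W 1≤h with x <? i
  step-last<hght nothing x i j W W′ 1≤x i<j ascending⇒W h≡i⇒W 1≤h | yes x<i
    rewrite >⇒≤ᵇ-false {i} {x} x<i | ≢⇒≡ᵇ-false {x} {j} (<⇒≢ (<-trans x<i i<j)) = ≈-sym zeros
    where
    zeros : (0# + 0#) + Σ[1‥ i ∸ 1 ] (λ _ → 0#) ≈ 0#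
    zeros = ≈-trans (+-congˡ (sumOver-0 (applyUpTo suc (i ∸ 1)))) (≈-trans (+-identityʳ _) (+-identityʳ _))
  step-last<hght (just h₀) x i j W W′ 1≤x i<j ascending⇒W h≡i⇒W 1≤h | yes x<i
    rewrite >⇒≤ᵇ-false {i} {x} x<i | ≢⇒≡ᵇ-false {x} {j} (<⇒≢ (<-trans x<i i<j)) =
    ≈-trans (height-unchanged (h₀ ≡ᵇ j) refl)
            (≈-sym (≈-trans (+-congˡ (sumOver-0 (applyUpTo suc (i ∸ 1)))) (≈-trans (+-identityʳ _) (+-identityʳ _))))
    where
    height-unchanged : ∀ b → (h₀ ≡ᵇ j) ≡ b → ind (not (i <ᵇ h₀)) (ind b W′) ≈ 0#
    height-unchanged false _ = ind-0 _
    height-unchanged true  e rewrite ≡ᵇ-true⇒≡ {h₀} {j} e | <⇒<ᵇ-true i<j = ≈-refl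
  step-last<hght h x i j W W′ 1≤x i<j ascending⇒W h≡i⇒W 1≤h | no x≮i
    rewrite ≤⇒≤ᵇ-true {i} {x} (≮⇒≥ x≮i) with x ≟ j | h
  ... | no x≢j | nothing rewrite ≢⇒≡ᵇ-false x≢j =
    ≈-sym (≈-trans (+-congˡ (sumOver-0 (applyUpTo suc (i ∸ 1)))) (≈-trans (+-identityʳ _) (+-identityʳ _)))
  ... | no x≢j | just h₀ rewrite ≢⇒≡ᵇ-false x≢j =
    ≈-trans (height-x (i <ᵇ h₀) refl)
            (≈-sym (≈-trans (+-congˡ (sumOver-0 (applyUpTo suc (i ∸ 1)))) (≈-trans (+-identityʳ _) (+-identityʳ _))))
    where
    height-x : ∀ b → (i <ᵇ h₀) ≡ b → ind (not b) (ind ((h₀ ⊔ x) ≡ᵇ j) W′) ≈ 0#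
    height-x true  _ = ≈-refl
    height-x false e =
      ≡⇒≈ (trans (cong (λ z → ind (z ≡ᵇ j) W′) (m≤n⇒m⊔n≡n (≤-trans (<ᵇ-false⇒≥ {i} {h₀} e) (≮⇒≥ x≮i))))
          (cong (λ b → ind b W′) (≢⇒≡ᵇ-false x≢j)))
  ... | yes refl | nothing rewrite ≡ᵇ-refl x =
    ≈-sym (≈-trans (+-congˡ (sumOver-0 (applyUpTo suc (i ∸ 1))))
                   (≈-trans (+-identityʳ _) (≈-trans (+-identityʳ _) (≈-sym (ascending⇒W refl)))))
  ... | yes refl | just h₀ rewrite ≡ᵇ-refl x with <-cmp h₀ i
  ...   | tri< h<i _ _ rewrite ≥⇒<ᵇ-false {i} {h₀} (<⇒≤ h<i) | m≤n⇒m⊔n≡n (≤-trans (<⇒≤ h<i) (≮⇒≥ x≮i))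
                             | ≡ᵇ-refl x | ≢⇒≡ᵇ-false {h₀} {i} (<⇒≢ h<i) =
    ≈-sym (≈-trans (+-cong (+-identityʳ _) (Σ-select (i ∸ 1) h₀ _ (1≤h h₀ refl) (<⇒≤pred h<i))) (+-identityˡ _))
  ...   | tri≈ _ refl _ rewrite <ᵇ-irrefl h₀ | m≤n⇒m⊔n≡n (≮⇒≥ x≮i) | ≡ᵇ-refl x | ≡ᵇ-refl h₀ =
    ≈-sym (≈-trans (+-cong (+-identityˡ _) (Σ-select-outside (h₀ ∸ 1) h₀ _ (pred-< {h₀} {h₀} (1≤h h₀ refl) ≤-refl)))
                   (≈-trans (+-identityʳ _) (≈-sym (h≡i⇒W refl))))
  ...   | tri> _ _ i<h rewrite <⇒<ᵇ-true i<h | ≢⇒≡ᵇ-false {h₀} {i} (λ h≡i → <-irrefl (sym h≡i) i<h) =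
    ≈-sym (≈-trans (+-cong (+-identityʳ _) (Σ-select-outside (i ∸ 1) h₀ _ (≤-trans (s≤s (m∸n≤m i 1)) i<h)))
                   (+-identityʳ _))

  u-last<hght : ∀ n i j → 3 ≤ n → 1 ≤ i → i < j → j ≤ n ∸ 1 →
    u n i j ≈ (δ j (n ∸ 1) * pow q (n ∸ 2) + u (n ∸ 1) j i
               + q * Σ[1‥ i ∸ 1 ] (λ k → u (n ∸ 2) (j ∸ 1) k + u (n ∸ 1) (j ∸ 1) k))
  u-last<hght (suc (suc p)) (suc i₁) (suc j₁) (s≤s (s≤s 1≤p)) 1≤i i<j j≤m = begin
    u (suc m) i j ≈⟨ u-append m i j 1≤i (≤-trans (<⇒≤ i<j) (m≤n⇒m≤1+n j≤m)) ⟩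
    _ ≈⟨ Σ𝒰-cong m (λ e e-inv _ → step e e-inv) ⟩
    _ ≈⟨ Σ𝒰-+ m _ _ ⟩
    _ ≈⟨ +-congʳ (Σ𝒰-+ m _ _) ⟩
    _ ≈⟨ +-cong (+-cong (Σ𝒰-descentFree m (λ e → ind (lastE e =ᴹ j) (weight e)) (s≤s z≤n)) (≈-sym (u≈Σ𝒰 m j i)))
                (Σ𝒰-Σ m i₁ (λ k e → ind (lastHght j k e) (weight (e ++ [ i ])))) ⟩
    _ ≈⟨ +-cong (+-congʳ (≡⇒≈ weight-ascending))
                (Σ-cong-range i₁ (λ k 1≤k k≤i₁ →
                  SplitByValue.Σ𝒰-weight-snoc-i k i₁ 1≤k (s≤s k≤i₁) p j₁ 1≤p (≤-pred i<j) (≤-pred j≤m))) ⟩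
    _ ≈⟨ +-cong (+-congʳ (ind≈indicator* (j ≡ᵇ m) _)) (Σ-* i₁ q _) ⟩
    _ ∎
    where
    m = suc p
    i = suc i₁
    j = suc j₁
    weight-ascending : ind (lastE (ascending m) =ᴹ j) (weight (ascending m)) ≡ ind (j ≡ᵇ m) (pow q p)
    weight-ascending rewrite last-ascending m (s≤s z≤n) | ≡ᵇ-sym m j | dist-ascending m = refl
    step : ∀ e → IsInvSeq m e → ind (not (i <ᴹ hght e)) (ind (hght (e ++ [ i ]) =ᴹ j) (weight (e ++ [ i ]))) ≈
           (ind (is-nothing (hght e)) (ind (lastE e =ᴹ j) (weight e)) + ind (lastHght j i e) (weight e))
           + Σ[1‥ i₁ ] (λ k → ind (lastHght j k e) (weight (e ++ [ i ])))
    step e e-inv with IsInvSeq-last e-inv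
    ... | x , lx , 1≤x , _ rewrite hght-snoc e i lx | lx =
      step-last<hght (hght e) x i j (weight e) (weight (e ++ [ i ])) 1≤x i<j
        (λ he → weight-snoc-∈ e i lx (subst (λ z → i ∈ᵇ z ≡ true) (sym (hght≡nothing⇒ascending e-inv he))
                                           (∈ᵇ-ascending m i 1≤i (≤-trans (<⇒≤ i<j) j≤m))))
        (λ he → weight-snoc-∈ e i lx (hght-∈ᵇ e-inv he))
        (λ h₀ he → proj₁ (hght-range e-inv he))

  u-3-2-2 : u 3 2 2 ≈ q
  u-3-2-2 = ≈-trans (+-identityʳ _) (*-identityʳ q)

  u-2-1-1 : u 2 1 1 ≈ 1#
  u-2-1-1 = +-identityʳ _

  u-2-2-1 : u 2 2 1 ≈ 0#
  u-2-2-1 = ≈-refl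

lemma2 : {c ℓ : Level} (R : CommutativeSemiring c ℓ) (q : CommutativeSemiring.Carrier R) →
    let open CommutativeSemiring R
        open Poly R q
    in ((n i j : ℕ) → 3 ≤ n → 1 ≤ i → i < j → j ≤ n ∸ 1 →
          u n i j ≈ (δ j (n ∸ 1) * pow q (n ∸ 2) + u (n ∸ 1) j i
                     + q * Σ[1‥ i ∸ 1 ] (λ k → u (n ∸ 2) (j ∸ 1) k + u (n ∸ 1) (j ∸ 1) k)))
     × ((n i j : ℕ) → 3 ≤ n → 1 ≤ j → j < i → i ≤ n →
          u n i j ≈ q * Σ[1‥ i ∸ 1 ] (λ l → u (n ∸ 1) l j))
     × ((n i : ℕ) → 3 ≤ n → 1 ≤ i → i ≤ n ∸ 2 →
          u n i i ≈ Σ[1‥ i ∸ 1 ] (λ k → u (n ∸ 1) i k) + Σ[1‥ i ] (λ l → u (n ∸ 1) l i))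
     × (u 3 2 2 ≈ q)
     × ((n : ℕ) → 4 ≤ n →
          u n (n ∸ 1) (n ∸ 1) ≈ pow q (n ∸ 2) + q * Σ[1‥ n ∸ 2 ] (λ i → Σ[1‥ n ∸ 3 ] (λ j → u (n ∸ 2) i j)))
     × (u 2 1 1 ≈ 1#)
     × (u 2 2 1 ≈ 0#)
lemma2 R q = u-last<hght , u-last>hght , u-last≡hght , u-3-2-2 , u-top , u-2-1-1 , u-2-2-1
  where open Recurrences R q
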